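{- Let $n$ be either $p^\alpha$ with $p$ an odd prime and $\alpha\ge 1$, or $n=p^\alpha q^\beta$ with $p,q$ distinct odd primes, $\alpha,\beta\ge1$ and $\gcd(\varphi(p^\alpha),\varphi(q^\beta))=2$; suppose in either case that $\varphi(n)/8$ is an odd integer. Then the biquadratic residues $\mathrm{mod}^\star\, n$ form a cyclic subgroup of $G_n^\star$ of order $\varphi(n)/8$, and for every biquadratic residue $b$ $\mathrm{mod}^\star\, n$, the integer $x=b^{(\varphi(n)/8+1)/2}$ satisfies $x^2\equiv b\ (\mathrm{mod}^\star\, n)$ and is itself a biquadratic residue $\mathrm{mod}^\star\, n$.
   Context: For a positive integer $n$ and integers $a,b$ coprime to $n$, write $a\equiv b\ (\mathrm{mod}^\star\, n)$ if $a-b\in n\mathbb{Z}$ or $a+b\in n\mathbb{Z}$. $G_n^\star$ is the group of equivalence classes of integers coprime to $n$ under this relation with multiplication $[a][b]=[ab]$. An integer $b$ coprime to $n$ is a biquadratic residue $\mathrm{mod}^\star\, n$ if $b\equiv y^4\ (\mathrm{mod}^\star\, n)$ for some integer $y$ coprime to $n$. $\varphi$ is Euler's totient function. -}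

module Defs where

open import Data.Nat as ℕ using (ℕ; suc)
open import Data.Nat.Coprimality as NC using (coprime?)
open import Data.List using (List; length; filter; map; upTo)
open import Data.Integer using (ℤ; +_; _-_; _+_; _^_)
open import Data.Integer.Divisibility using (_∣_)
open import Data.Integer.Coprimality using (Coprime)
open import Data.Product using (Σ; _×_)
open import Data.Sum using (_⊎_)

φ : ℕ → ℕ
φ n = length (filter (λ k → coprime? k n) (map suc (upTo n)))

_≡⋆_[mod_] : ℤ → ℤ → ℕ → Set
a ≡⋆ b [mod n ] = ((+ n) ∣ (a - b)) ⊎ ((+ n) ∣ (a + b))

CoprimeTo : ℕ → ℤ → Set
CoprimeTo n b = Coprime b (+ n)

BiquadraticResidue⋆ : ℕ → ℤ → Set
BiquadraticResidue⋆ n b =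
  CoprimeTo n b × Σ ℤ (λ y → CoprimeTo n y × (b ≡⋆ (y ^ 4) [mod n ]))

module Submission where

-- Everything follows from a "fourth-power structure" on the units modulo n
-- (FourthPowerStructure): a unit g₀ such that (i) the fourth power of every
-- unit is a power of g = g₀⁴, (ii) y^(4m) ≡ ±1 for every unit y, and
-- (iii) g^i ≡ ±1 only if m ∣ i.  Then the biquadratic residues are exactly the
-- powers of g, g has order m up to sign, and for b ≡ ±y⁴ we get b^m ≡ ±1, so
-- (b^((m+1)/2))² = b^m·b ≡ ±b (structure⇒conclusion).
--
-- The structure comes from primitive roots.

module NumberTheory where

  open import Data.Nat as ℕ using (ℕ; zero; suc; z≤n; s≤s)
  import Data.Nat.Properties as ℕP
  open import Data.Nat.Divisibility as ℕD using () renaming (_∣_ to _∣ℕ_)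
  open import Data.Nat.DivMod using (_%_; _/_; m≡m%n+[m/n]*n; m%n<n; [m+kn]%n≡m%n; m<n⇒m%n≡m)
  open import Data.Nat.Primality using (Prime; euclidsLemma; prime⇒irreducible; prime⇒nonZero; prime⇒nonTrivial; prime[2])
  open import Data.Nat.Primality.Factorisation using (factorise)
  open import Data.Nat.Coprimality as NC using (Coprime; coprime?)
  open import Data.Nat.GCD using (gcd; gcd-GCD; gcd[m,n]∣m; gcd[m,n]∣n; c*gcd[m,n]≡gcd[cm,cn]; module Bézout)
  open import Data.Nat.Combinatorics using (_C_; nCk+nC[k+1]≡[n+1]C[k+1]; k>n⇒nCk≡0; nCn≡1; nC1≡n; nCk≡nC[n∸k])
  open import Data.Nat.ListAction using (product)
  open import Data.Nat.Induction using (<-rec)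
  import Data.Nat.Tactic.RingSolver as ℕSolver
  open import Data.Integer as ℤ using (ℤ; +_; -_; _+_; _-_; _*_; _^_; ∣_∣)
  import Data.Integer.Properties as ℤP
  import Data.Integer.DivMod as ℤDM
  open import Data.Integer.Divisibility.Signed as ℤD using (_∣_)
  open import Data.Integer.Tactic.RingSolver using (solve-∀)
  open import Data.Bool using (Bool; true; false; not; _∧_)
  open import Data.Fin as F using (Fin; toℕ)
  import Data.Fin.Properties as FP
  open import Data.Vec using (Vec; []; _∷_; replicate)
  open import Data.List using ([]; _∷_; _++_; map; length; filter; upTo; [_])
  import Data.List.Properties as ListP
  open import Data.List.Relation.Unary.All using (_∷_)
  open import Data.Product using (Σ; ∃; _×_; _,_; proj₁; proj₂)
  open import Data.Sum using (_⊎_; inj₁; inj₂)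
  open import Data.Empty using (⊥-elim)
  open import Function using (_∘_)
  open import Relation.Nullary using (¬_; yes; no; Dec; does; ¬?; _×-dec_)
  open import Relation.Nullary.Decidable using (dec-true; dec-false; does-≡; map′)
  open import Relation.Binary.Bundles using (Setoid)
  import Relation.Binary.Reasoning.Setoid as SetoidReasoning
  open import Relation.Binary.PropositionalEquality hiding ([_])
  open import Defs

  -- Congruence of integers modulo an integer M.  It is a record (rather than
  -- a bare divisibility statement) so that M can be inferred from a proof.
  infix 4 _≈_[mod_]
  record _≈_[mod_] (a b M : ℤ) : Set where
    constructor congruent
    field divides-difference : M ∣ (a - b)
  open _≈_[mod_] public

  ≈-refl : ∀ {M} a → a ≈ a [mod M ]
  ≈-refl {M} a = congruent (ℤD.divides (+ 0) (trans (ℤP.+-inverseʳ a) (sym (ℤP.*-zeroˡ M))))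

  ≈-reflexive : ∀ {M a b} → a ≡ b → a ≈ b [mod M ]
  ≈-reflexive {b = b} refl = ≈-refl b

  ≈-sym : ∀ {M a b} → a ≈ b [mod M ] → b ≈ a [mod M ]
  ≈-sym {a = a} {b} (congruent d) = congruent (subst (_ ∣_) (negate-difference a b) (ℤD.∣m⇒∣-m d))
    where negate-difference : ∀ (a b : ℤ) → - (a - b) ≡ b - a
          negate-difference = solve-∀

  ≈-trans : ∀ {M a b c} → a ≈ b [mod M ] → b ≈ c [mod M ] → a ≈ c [mod M ]
  ≈-trans {a = a} {b} {c} (congruent d) (congruent e) =
    congruent (subst (_ ∣_) (telescope a b c) (ℤD.∣m∣n⇒∣m+n d e))
    where telescope : ∀ (a b c : ℤ) → (a - b) + (b - c) ≡ a - c
          telescope = solve-∀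

  ≈-setoid : ℤ → Setoid _ _
  ≈-setoid M = record
    { Carrier = ℤ
    ; _≈_ = λ a b → a ≈ b [mod M ]
    ; isEquivalence = record { refl = ≈-refl _ ; sym = ≈-sym ; trans = ≈-trans }
    }

  module ≈-Reasoning (M : ℤ) = SetoidReasoning (≈-setoid M)

  ≈-+ : ∀ {M a b c d} → a ≈ b [mod M ] → c ≈ d [mod M ] → a + c ≈ b + d [mod M ]
  ≈-+ {a = a} {b} {c} {d} (congruent p) (congruent q) =
    congruent (subst (_ ∣_) (regroup a b c d) (ℤD.∣m∣n⇒∣m+n p q))
    where regroup : ∀ (a b c d : ℤ) → (a - b) + (c - d) ≡ (a + c) - (b + d)
          regroup = solve-∀

  ≈-* : ∀ {M a b c d} → a ≈ b [mod M ] → c ≈ d [mod M ] → a * c ≈ b * d [mod M ]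
  ≈-* {a = a} {b} {c} {d} (congruent p) (congruent q) =
    congruent (subst (_ ∣_) (regroup a b c d) (ℤD.∣m∣n⇒∣m+n (ℤD.∣m⇒∣m*n c p) (ℤD.∣n⇒∣m*n b q)))
    where regroup : ∀ (a b c d : ℤ) → (a - b) * c + b * (c - d) ≡ a * c - b * d
          regroup = solve-∀

  ≈-*ˡ : ∀ {M a b} c → a ≈ b [mod M ] → c * a ≈ c * b [mod M ]
  ≈-*ˡ c = ≈-* (≈-refl c)

  ≈-*ʳ : ∀ {M a b} c → a ≈ b [mod M ] → a * c ≈ b * c [mod M ]
  ≈-*ʳ c p = ≈-* p (≈-refl c)

  ≈-^ : ∀ {M a b} n → a ≈ b [mod M ] → a ^ n ≈ b ^ n [mod M ]
  ≈-^ zero    p = ≈-refl _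
  ≈-^ (suc n) p = ≈-* p (≈-^ n p)

  ≈-divisor : ∀ {M M′ a b} → M ∣ M′ → a ≈ b [mod M′ ] → a ≈ b [mod M ]
  ≈-divisor d (congruent p) = congruent (ℤD.∣-trans d p)

  ≈-modulus : ∀ {M M′ a b} → M ≡ M′ → a ≈ b [mod M ] → a ≈ b [mod M′ ]
  ≈-modulus refl p = p

  ^-* : ∀ x m n → x ^ (m ℕ.* n) ≡ (x ^ m) ^ n
  ^-* x m n = sym (ℤP.^-*-assoc x m n)

  ^-*-comm : ∀ x m n → (x ^ m) ^ n ≡ (x ^ n) ^ m
  ^-*-comm x m n = trans (ℤP.^-*-assoc x m n) (trans (cong (x ^_) (ℕP.*-comm m n)) (^-* x n m))

  ^-distrib-* : ∀ x y n → (x * y) ^ n ≡ x ^ n * y ^ n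
  ^-distrib-* x y zero    = refl
  ^-distrib-* x y (suc n) = trans (cong ((x * y) *_) (^-distrib-* x y n)) (interchange x y (x ^ n) (y ^ n))
    where interchange : ∀ (a b c d : ℤ) → a * b * (c * d) ≡ a * c * (b * d)
          interchange = solve-∀

  ^-double : ∀ x n → x ^ n * x ^ n ≡ x ^ (2 ℕ.* n)
  ^-double x n = trans (sym (ℤP.^-distribˡ-+-* x n n)) (cong (λ k → x ^ (n ℕ.+ k)) (sym (ℕP.+-identityʳ n)))

  ≈1-^ : ∀ {M x} n → x ≈ + 1 [mod M ] → x ^ n ≈ + 1 [mod M ]
  ≈1-^ n p = ≈-trans (≈-^ n p) (≈-reflexive (ℤP.^-zeroˡ n))

  ≈1-multiple : ∀ {M x e} i → x ^ e ≈ + 1 [mod M ] → e ∣ℕ i → x ^ i ≈ + 1 [mod M ]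
  ≈1-multiple {M} {x} {e} i p (ℕD.divides q refl) =
    subst (λ j → x ^ j ≈ + 1 [mod M ]) (ℕP.*-comm e q) (≈-trans (≈-reflexive (^-* x e q)) (≈1-^ q p))

  pos-^ : ∀ p n → + (p ℕ.^ n) ≡ (+ p) ^ n
  pos-^ p zero    = refl
  pos-^ p (suc n) = trans (ℤP.pos-* p (p ℕ.^ n)) (cong (+ p *_) (pos-^ p n))

  prime>1 : ∀ {p} → Prime p → 1 ℕ.< p
  prime>1 {p} pr = ℕ.nonTrivial⇒n>1 p {{prime⇒nonTrivial pr}}

  prime≢1 : ∀ {p} → Prime p → p ≢ 1
  prime≢1 pr = ℕ.nonTrivial⇒≢1 {{prime⇒nonTrivial pr}}

  prime∤1 : ∀ {p} → Prime p → ¬ (+ p ∣ + 1)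
  prime∤1 pr d = prime≢1 pr (ℕD.∣1⇒≡1 (ℤD.∣⇒∣ᵤ d))

  euclidsLemmaℤ : ∀ {p} a b → Prime p → + p ∣ a * b → (+ p ∣ a) ⊎ (+ p ∣ b)
  euclidsLemmaℤ {p} a b pr d with euclidsLemma ∣ a ∣ ∣ b ∣ pr (subst (p ∣ℕ_) (ℤP.abs-* a b) (ℤD.∣⇒∣ᵤ d))
  ... | inj₁ p∣a = inj₁ (ℤD.∣ᵤ⇒∣ p∣a)
  ... | inj₂ p∣b = inj₂ (ℤD.∣ᵤ⇒∣ p∣b)

  prime∤* : ∀ {p} → Prime p → ∀ {a b} → ¬ (+ p ∣ a) → ¬ (+ p ∣ b) → ¬ (+ p ∣ a * b)
  prime∤* pr {a} {b} p∤a p∤b d with euclidsLemmaℤ a b pr d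
  ... | inj₁ p∣a = p∤a p∣a
  ... | inj₂ p∣b = p∤b p∣b

  prime∤^ : ∀ {p} → Prime p → ∀ {a} → ¬ (+ p ∣ a) → ∀ k → ¬ (+ p ∣ a ^ k)
  prime∤^ pr p∤a zero    = prime∤1 pr
  prime∤^ pr p∤a (suc k) = prime∤* pr p∤a (prime∤^ pr p∤a k)

  prime∤⇒coprime : ∀ {l d} → Prime l → ¬ (l ∣ℕ d) → Coprime l d
  prime∤⇒coprime pr l∤d (i∣l , i∣d) with prime⇒irreducible pr i∣l
  ... | inj₁ i≡1  = i≡1
  ... | inj₂ refl = ⊥-elim (l∤d i∣d)

  coprime-*ˡ : ∀ {a b c} → Coprime a c → Coprime b c → Coprime (a ℕ.* b) c
  coprime-*ˡ {a} {b} ac bc (i∣ab , i∣c) = bc (NC.coprime-divisor ia i∣ab , i∣c)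
    where ia : Coprime _ a
          ia (j∣i , j∣a) = ac (j∣a , ℕD.∣-trans j∣i i∣c)

  coprime-^ˡ : ∀ {a c} → Coprime a c → ∀ k → Coprime (a ℕ.^ k) c
  coprime-^ˡ a⊥c zero    (i∣1 , _) = ℕD.∣1⇒≡1 i∣1
  coprime-^ˡ a⊥c (suc k) = coprime-*ˡ a⊥c (coprime-^ˡ a⊥c k)

  prime^-coprime : ∀ {l d} → Prime l → ¬ (l ∣ℕ d) → ∀ k → Coprime (l ℕ.^ k) d
  prime^-coprime pr l∤d = coprime-^ˡ (prime∤⇒coprime pr l∤d)

  coprime-∣* : ∀ {u v i} → Coprime u v → u ∣ℕ i → v ∣ℕ i → u ℕ.* v ∣ℕ i
  coprime-∣* {u} {v} c (ℕD.divides q refl) v∣qu =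
    subst (u ℕ.* v ∣ℕ_) (ℕP.*-comm u q)
          (ℕD.*-monoʳ-∣ u (NC.coprime-divisor (NC.sym c) (subst (v ∣ℕ_) (ℕP.*-comm q u) v∣qu)))

  distinct-primes-coprime : ∀ {p q} → Prime p → Prime q → p ≢ q → Coprime p q
  distinct-primes-coprime {p} {q} pp pq p≢q = NC.sym (prime∤⇒coprime pq q∤p)
    where q∤p : ¬ (q ∣ℕ p)
          q∤p d with prime⇒irreducible pp d
          ... | inj₁ q≡1 = prime≢1 pq q≡1
          ... | inj₂ q≡p = p≢q (sym q≡p)

  ^-monoʳ-∣ : ∀ l {j k} → j ℕ.≤ k → l ℕ.^ j ∣ℕ l ℕ.^ k
  ^-monoʳ-∣ l {j} {k} j≤k = ℕD.divides (l ℕ.^ (k ℕ.∸ j)) (begin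
    l ℕ.^ k                           ≡⟨ cong (l ℕ.^_) (ℕP.m+[n∸m]≡n j≤k) ⟨
    l ℕ.^ (j ℕ.+ (k ℕ.∸ j))           ≡⟨ ℕP.^-distribˡ-+-* l j (k ℕ.∸ j) ⟩
    l ℕ.^ j ℕ.* l ℕ.^ (k ℕ.∸ j)       ≡⟨ ℕP.*-comm (l ℕ.^ j) _ ⟩
    l ℕ.^ (k ℕ.∸ j) ℕ.* l ℕ.^ j       ∎)
    where open ≡-Reasoning

  divisor-of-prime^ : ∀ {l} → Prime l → ∀ k d → d ∣ℕ l ℕ.^ k → Σ ℕ λ j → j ℕ.≤ k × d ≡ l ℕ.^ j
  divisor-of-prime^ pr zero d d∣1 = 0 , z≤n , ℕD.∣1⇒≡1 d∣1
  divisor-of-prime^ {l} pr (suc k) d d∣ with l ℕD.∣? d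
  ... | yes (ℕD.divides c refl)
    with divisor-of-prime^ pr k c (ℕD.*-cancelˡ-∣ l {{prime⇒nonZero pr}} (subst (_∣ℕ l ℕ.* l ℕ.^ k) (ℕP.*-comm c l) d∣))
  ... | j , j≤k , refl = suc j , s≤s j≤k , ℕP.*-comm (l ℕ.^ j) l
  divisor-of-prime^ {l} pr (suc k) d d∣ | no l∤d
    with divisor-of-prime^ pr k d (NC.coprime-divisor (NC.sym (prime∤⇒coprime pr l∤d)) d∣)
  ... | j , j≤k , d≡ = j , ℕP.m≤n⇒m≤1+n j≤k , d≡

  prime^-cancel : ∀ {p} → Prime p → ∀ α {a b} → ¬ (+ p ∣ a) → + (p ℕ.^ α) ∣ a * b → + (p ℕ.^ α) ∣ b
  prime^-cancel pr α {a} {b} p∤a d = ℤD.∣ᵤ⇒∣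
    (NC.coprime-divisor (prime^-coprime pr (λ p∣a → p∤a (ℤD.∣ᵤ⇒∣ p∣a)) α)
                        (subst (_ ∣ℕ_) (ℤP.abs-* a b) (ℤD.∣⇒∣ᵤ d)))

  odd-prime : ∀ {p} → Prime p → p ≢ 2 → Σ ℕ λ h → p ≡ 1 ℕ.+ 2 ℕ.* h
  odd-prime {p} pr p≢2 with p % 2 | m≡m%n+[m/n]*n p 2 | m%n<n p 2
  ... | 0 | p≡ | _ = ⊥-elim (2∤p (ℕD.divides (p / 2) p≡))
    where 2∤p : ¬ (2 ∣ℕ p)
          2∤p d with prime⇒irreducible pr d
          ... | inj₂ 2≡p = p≢2 (sym 2≡p)
  ... | 1 | p≡ | _ = p / 2 , trans p≡ (cong suc (ℕP.*-comm (p / 2) 2))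
  ... | suc (suc _) | _ | s≤s (s≤s ())

  odd-prime∤2 : ∀ {p} → Prime p → p ≢ 2 → ¬ (+ p ∣ + 2)
  odd-prime∤2 {p} pr p≢2 d = p≢2 (ℕP.≤-antisym (ℕD.∣⇒≤ (ℤD.∣⇒∣ᵤ d)) (prime>1 pr))

  prime^-∣-split : ∀ {p} → Prime p → ∀ α u v → (+ p ∣ u → ¬ (+ p ∣ v)) →
                   + (p ℕ.^ α) ∣ u * v → (+ (p ℕ.^ α) ∣ u) ⊎ (+ (p ℕ.^ α) ∣ v)
  prime^-∣-split {p} pr α u v not-both d with + p ℤD.∣? u
  ... | yes p∣u = inj₁ (prime^-cancel pr α (not-both p∣u) (subst (_ ∣_) (ℤP.*-comm u v) d))
  ... | no  p∤u = inj₂ (prime^-cancel pr α p∤u d)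

  -- Modulo a power of an odd prime, the only square roots of 1 are ±1:
  -- p^α divides (x - 1)(x + 1), and p cannot divide both factors.
  sqrt-of-one : ∀ {p} → Prime p → p ≢ 2 → ∀ α x → x * x ≈ + 1 [mod + (p ℕ.^ α) ] →
                x ≈ + 1 [mod + (p ℕ.^ α) ] ⊎ x ≈ - + 1 [mod + (p ℕ.^ α) ]
  sqrt-of-one {p} pr p≢2 α x (congruent d)
    with prime^-∣-split pr α (x - + 1) (x + + 1) not-both (subst (_ ∣_) (factor x) d)
    where
    factor : ∀ (x : ℤ) → x * x - + 1 ≡ (x - + 1) * (x + + 1)
    factor = solve-∀
    difference : ∀ (x : ℤ) → (x + + 1) - (x - + 1) ≡ + 2
    difference = solve-∀
    not-both : + p ∣ x - + 1 → ¬ (+ p ∣ x + + 1)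
    not-both p∣x-1 p∣x+1 = odd-prime∤2 pr p≢2 (subst (_ ∣_) (difference x) (ℤD.∣m∣n⇒∣m-n p∣x+1 p∣x-1))
  ... | inj₁ d₁ = inj₁ (congruent d₁)
  ... | inj₂ d₂ = inj₂ (congruent (subst (_ ∣_) (plus x) d₂))
    where plus : ∀ (x : ℤ) → x + + 1 ≡ x - - + 1
          plus = solve-∀

  pascal : ∀ n k → suc n C suc k ≡ n C k ℕ.+ n C suc k
  pascal n k = sym (nCk+nC[k+1]≡[n+1]C[k+1] n k)

  nC0≡1 : ∀ n → n C 0 ≡ 1
  nC0≡1 n = trans (nCk≡nC[n∸k] {n = n} z≤n) (nCn≡1 n)

  absorption : ∀ n k → suc k ℕ.* (suc n C suc k) ≡ suc n ℕ.* (n C k)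
  absorption zero zero = cong (1 ℕ.*_) (nCn≡1 1)
  absorption zero (suc k) = trans (cong (suc (suc k) ℕ.*_) (k>n⇒nCk≡0 {1} {suc (suc k)} (s≤s (s≤s z≤n))))
                                  (trans (ℕP.*-zeroʳ (suc (suc k))) (cong (1 ℕ.*_) (sym (k>n⇒nCk≡0 {0} {suc k} (s≤s z≤n)))))
  absorption (suc n) k = begin
    suc k ℕ.* (suc (suc n) C suc k)                         ≡⟨ cong (suc k ℕ.*_) (pascal (suc n) k) ⟩
    suc k ℕ.* (suc n C k ℕ.+ suc n C suc k)                 ≡⟨ ℕP.*-distribˡ-+ (suc k) (suc n C k) _ ⟩
    suc k ℕ.* (suc n C k) ℕ.+ suc k ℕ.* (suc n C suc k)     ≡⟨ cong (suc k ℕ.* (suc n C k) ℕ.+_) (absorption n k) ⟩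
    suc k ℕ.* (suc n C k) ℕ.+ suc n ℕ.* (n C k)             ≡⟨ lower k ⟩
    suc (suc n) ℕ.* (suc n C k)                             ∎
    where
    open ≡-Reasoning
    lower : ∀ k → suc k ℕ.* (suc n C k) ℕ.+ suc n ℕ.* (n C k) ≡ suc (suc n) ℕ.* (suc n C k)
    lower zero = begin
      1 ℕ.* (suc n C 0) ℕ.+ suc n ℕ.* (n C 0)   ≡⟨ cong₂ (λ a b → 1 ℕ.* a ℕ.+ suc n ℕ.* b) (nC0≡1 (suc n)) (nC0≡1 n) ⟩
      1 ℕ.* 1 ℕ.+ suc n ℕ.* 1                   ≡⟨⟩
      suc (suc n) ℕ.* 1                         ≡⟨ cong (suc (suc n) ℕ.*_) (nC0≡1 (suc n)) ⟨
      suc (suc n) ℕ.* (suc n C 0)               ∎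
    lower (suc k) = begin
      suc (suc k) ℕ.* c ℕ.+ suc n ℕ.* (n C suc k)                  ≡⟨⟩
      c ℕ.+ suc k ℕ.* c ℕ.+ suc n ℕ.* (n C suc k)                  ≡⟨ cong (λ t → c ℕ.+ t ℕ.+ suc n ℕ.* (n C suc k)) (absorption n k) ⟩
      c ℕ.+ suc n ℕ.* (n C k) ℕ.+ suc n ℕ.* (n C suc k)            ≡⟨ merge (n C k) (n C suc k) ⟩
      c ℕ.+ suc n ℕ.* (n C k ℕ.+ n C suc k)                        ≡⟨ cong (λ t → c ℕ.+ suc n ℕ.* t) (pascal n k) ⟨
      suc (suc n) ℕ.* c                                            ∎
      where
      c = suc n C suc k
      merge : ∀ a b → c ℕ.+ suc n ℕ.* a ℕ.+ suc n ℕ.* b ≡ c ℕ.+ suc n ℕ.* (a ℕ.+ b)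
      merge a b = trans (ℕP.+-assoc c _ _) (cong (c ℕ.+_) (sym (ℕP.*-distribˡ-+ (suc n) a b)))

  -- p divides C(p,k) for 0 < k < p: by absorption p ∣ k·C(p,k), and p ∤ k.
  prime∣binomial : ∀ {p} → Prime p → ∀ k → 0 ℕ.< k → k ℕ.< p → p ∣ℕ p C k
  prime∣binomial {suc n} pr (suc k) _ k<p
    with euclidsLemma (suc k) (suc n C suc k) pr (ℕD.divides (n C k) (trans (absorption n k) (ℕP.*-comm (suc n) (n C k))))
  ... | inj₁ p∣k = ⊥-elim (ℕP.<⇒≱ k<p (ℕD.∣⇒≤ p∣k))
  ... | inj₂ p∣C = p∣C

  binomial-sum : ℕ → ℤ → ℕ → ℤ
  binomial-sum n x zero    = + 0
  binomial-sum n x (suc j) = binomial-sum n x j + + (n C j) * x ^ j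

  binomial-sum-pascal : ∀ n x j →
    binomial-sum (suc n) x (suc j) ≡ binomial-sum n x (suc j) + x * binomial-sum n x j
  binomial-sum-pascal n x zero = begin
    + 0 + + (suc n C 0) * + 1       ≡⟨ cong (λ c → + 0 + + c * + 1) (trans (nC0≡1 (suc n)) (sym (nC0≡1 n))) ⟩
    + 0 + + (n C 0) * + 1           ≡⟨ regroup (+ (n C 0)) x ⟩
    + 0 + + (n C 0) * + 1 + x * + 0 ∎
    where
    open ≡-Reasoning
    regroup : ∀ (c x : ℤ) → + 0 + c * + 1 ≡ + 0 + c * + 1 + x * + 0
    regroup = solve-∀
  binomial-sum-pascal n x (suc j) = begin
    binomial-sum (suc n) x (suc j) + + (suc n C suc j) * x ^ suc j
      ≡⟨ cong₂ _+_ (binomial-sum-pascal n x j) (cong (_* x ^ suc j) (trans (cong +_ (pascal n j)) (ℤP.pos-+ (n C j) (n C suc j)))) ⟩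
    (S₁ + x * S₀) + (+ (n C j) + + (n C suc j)) * (x * x ^ j)
      ≡⟨ regroup S₁ x S₀ (+ (n C j)) (+ (n C suc j)) (x ^ j) ⟩
    (S₁ + + (n C suc j) * (x * x ^ j)) + x * (S₀ + + (n C j) * x ^ j) ∎
    where
    open ≡-Reasoning
    S₀ = binomial-sum n x j
    S₁ = binomial-sum n x (suc j)
    regroup : ∀ (a x c d e f : ℤ) → (a + x * c) + (d + e) * (x * f) ≡ (a + e * (x * f)) + x * (c + d * f)
    regroup = solve-∀

  binomial-theorem : ∀ n x → (x + + 1) ^ n ≡ binomial-sum n x (suc n)
  binomial-theorem zero x = refl
  binomial-theorem (suc n) x = begin
    (x + + 1) * (x + + 1) ^ n                        ≡⟨ cong ((x + + 1) *_) (binomial-theorem n x) ⟩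
    (x + + 1) * S                                    ≡⟨ distrib x S ⟩
    S + x * S                                        ≡⟨ cong (_+ x * S) top-term-vanishes ⟨
    binomial-sum n x (suc (suc n)) + x * S            ≡⟨ binomial-sum-pascal n x (suc n) ⟨
    binomial-sum (suc n) x (suc (suc n))              ∎
    where
    open ≡-Reasoning
    S = binomial-sum n x (suc n)
    distrib : ∀ (x a : ℤ) → (x + + 1) * a ≡ a + x * a
    distrib = solve-∀
    top-term-vanishes : binomial-sum n x (suc (suc n)) ≡ S
    top-term-vanishes = begin
      S + + (n C suc n) * x ^ suc n ≡⟨ cong (λ c → S + + c * x ^ suc n) (k>n⇒nCk≡0 (ℕP.n<1+n n)) ⟩
      S + + 0 * x ^ suc n           ≡⟨ cong (λ t → S + t) (ℤP.*-zeroˡ (x ^ suc n)) ⟩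
      S + + 0                       ≡⟨ ℤP.+-identityʳ S ⟩
      S                             ∎

  -- Modulo p the inner binomial terms vanish, leaving the constant term 1.
  binomial-sum-mod-prime : ∀ {p} → Prime p → ∀ x j → 0 ℕ.< j → j ℕ.≤ p → binomial-sum p x j ≈ + 1 [mod + p ]
  binomial-sum-mod-prime {p} pr x (suc zero) _ _ = ≈-reflexive (constant-term (+ (p C 0)) (cong +_ (nC0≡1 p)))
    where constant-term : ∀ c → c ≡ + 1 → + 0 + c * + 1 ≡ + 1
          constant-term c refl = refl
  binomial-sum-mod-prime {p} pr x (suc (suc j)) _ j<p = begin
    binomial-sum p x (suc j) + + (p C suc j) * x ^ suc j
      ≈⟨ ≈-+ (binomial-sum-mod-prime pr x (suc j) (s≤s z≤n) (ℕP.<⇒≤ j<p)) inner-term ⟩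
    + 1 + + 0
      ≡⟨ ℤP.+-identityʳ (+ 1) ⟩
    + 1 ∎
    where
    open ≈-Reasoning (+ p)
    inner-term : + (p C suc j) * x ^ suc j ≈ + 0 [mod + p ]
    inner-term = congruent (subst (_ ∣_) (sym (ℤP.+-identityʳ _))
      (ℤD.∣m⇒∣m*n (x ^ suc j) (ℤD.∣ᵤ⇒∣ {i = + (p C suc j)} (prime∣binomial pr (suc j) (s≤s z≤n) j<p))))

  freshmans-dream : ∀ {p} → Prime p → ∀ x → (x + + 1) ^ p ≈ x ^ p + + 1 [mod + p ]
  freshmans-dream {p} pr x = begin
    (x + + 1) ^ p                                ≡⟨ binomial-theorem p x ⟩
    binomial-sum p x p + + (p C p) * x ^ p        ≈⟨ ≈-+ (binomial-sum-mod-prime pr x p (prime>0) ℕP.≤-refl) (≈-refl _) ⟩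
    + 1 + + (p C p) * x ^ p                      ≡⟨ cong (λ c → + 1 + + c * x ^ p) (nCn≡1 p) ⟩
    + 1 + + 1 * x ^ p                            ≡⟨ cong (λ t → + 1 + t) (ℤP.*-identityˡ (x ^ p)) ⟩
    + 1 + x ^ p                                  ≡⟨ ℤP.+-comm (+ 1) (x ^ p) ⟩
    x ^ p + + 1                                  ∎
    where
    open ≈-Reasoning (+ p)
    prime>0 : 0 ℕ.< p
    prime>0 = ℕP.<-trans (s≤s z≤n) (prime>1 pr)

  -- Fermat's little theorem  a^p ≡ a (mod p),  first for natural numbers by
  -- induction using the freshman's dream, then for all integers by reduction mod p.
  fermatℕ : ∀ {p} → Prime p → ∀ a → (+ a) ^ p ≈ + a [mod + p ]
  fermatℕ {zero}   pr zero = ⊥-elim (ℕP.<⇒≱ (prime>1 pr) z≤n)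
  fermatℕ {suc p}  pr zero = ≈-reflexive (ℤP.*-zeroˡ ((+ 0) ^ p))
  fermatℕ {p} pr (suc a) = begin
    (+ suc a) ^ p          ≡⟨ cong (_^ p) (ℤP.+-comm (+ 1) (+ a)) ⟩
    (+ a + + 1) ^ p        ≈⟨ freshmans-dream pr (+ a) ⟩
    (+ a) ^ p + + 1        ≈⟨ ≈-+ (fermatℕ pr a) (≈-refl (+ 1)) ⟩
    + a + + 1              ≡⟨ ℤP.+-comm (+ a) (+ 1) ⟩
    + suc a                ∎
    where open ≈-Reasoning (+ p)

  fermat : ∀ {p} → Prime p → ∀ a → a ^ p ≈ a [mod + p ]
  fermat {p} pr a = begin
    a ^ p           ≈⟨ ≈-^ p a≈r ⟩
    (+ r) ^ p       ≈⟨ fermatℕ pr r ⟩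
    + r             ≈⟨ a≈r ⟨
    a               ∎
    where
    open ≈-Reasoning (+ p)
    instance _ = prime⇒nonZero pr
    r = a ℤDM.% + p
    a≈r : a ≈ + r [mod + p ]
    a≈r = congruent (ℤD.divides (a ℤDM./ + p) (subtract (ℤDM.a≡a%n+[a/n]*n a (+ p))))
      where
      subtract : ∀ {a r m} → a ≡ r + m → a - r ≡ m
      subtract {a} {r} {m} refl = cancel r m
        where cancel : ∀ (r m : ℤ) → r + m - r ≡ m
              cancel = solve-∀

  -- Fermat's little theorem in the form  a^(p-1) ≡ 1 (mod p)  for p ∤ a:
  -- p divides a·(a^(p-1) - 1) but not a.
  fermat-unit : ∀ {p} → Prime p → ∀ a → ¬ (+ p ∣ a) → a ^ (p ℕ.∸ 1) ≈ + 1 [mod + p ]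
  fermat-unit {zero} pr a p∤a = ⊥-elim (ℕP.<⇒≱ (prime>1 pr) z≤n)
  fermat-unit {suc p} pr a p∤a = congruent (subst (_∣ (a ^ p - + 1)) (cong +_ (ℕP.*-identityʳ (suc p)))
    (prime^-cancel pr 1 p∤a (subst₂ _∣_ (cong +_ (sym (ℕP.*-identityʳ (suc p)))) (factor a (a ^ p))
                                         (divides-difference (fermat pr a)))))
    where factor : ∀ (a b : ℤ) → a * b - a ≡ a * (b - + 1)
          factor = solve-∀

  record HasOrder (M a : ℤ) (e : ℕ) : Set where
    constructor hasOrder
    field
      pow-order≈1 : a ^ e ≈ + 1 [mod M ]
      order∣      : ∀ i → a ^ i ≈ + 1 [mod M ] → e ∣ℕ i
  open HasOrder public

  ≈1-difference : ∀ {M a} d u → a ^ u ≈ + 1 [mod M ] → a ^ (d ℕ.+ u) ≈ + 1 [mod M ] → a ^ d ≈ + 1 [mod M ]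
  ≈1-difference {M} {a} d u a^u≈1 a^d+u≈1 = begin
    a ^ d              ≡⟨ ℤP.*-identityʳ (a ^ d) ⟨
    a ^ d * + 1        ≈⟨ ≈-*ˡ (a ^ d) a^u≈1 ⟨
    a ^ d * a ^ u      ≡⟨ ℤP.^-distribˡ-+-* a d u ⟨
    a ^ (d ℕ.+ u)      ≈⟨ a^d+u≈1 ⟩
    + 1                ∎
    where open ≈-Reasoning M

  -- The exponents i with a^i ≡ 1 are closed under gcd (by Bézout's identity).
  ≈1-gcd : ∀ {M a} i j → a ^ i ≈ + 1 [mod M ] → a ^ j ≈ + 1 [mod M ] → a ^ gcd i j ≈ + 1 [mod M ]
  ≈1-gcd {M} {a} i j a^i≈1 a^j≈1 with Bézout.identity (gcd-GCD i j)
  ... | Bézout.+- x y d+yj≡xi =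
    ≈1-difference (gcd i j) (y ℕ.* j) (≈1-multiple _ a^j≈1 (ℕD.n∣m*n y))
                  (subst (λ k → a ^ k ≈ + 1 [mod M ]) (sym d+yj≡xi) (≈1-multiple _ a^i≈1 (ℕD.n∣m*n x)))
  ... | Bézout.-+ x y d+xi≡yj =
    ≈1-difference (gcd i j) (x ℕ.* i) (≈1-multiple _ a^i≈1 (ℕD.n∣m*n x))
                  (subst (λ k → a ^ k ≈ + 1 [mod M ]) (sym d+xi≡yj) (≈1-multiple _ a^j≈1 (ℕD.n∣m*n y)))

  -- Otherwise the gcd of i and
  -- l^(e+1), a power l^j with j ≤ e, would already kill a.
  prime^-order : ∀ {M a l} → Prime l → ∀ e → a ^ (l ℕ.^ suc e) ≈ + 1 [mod M ] →
                 ¬ (a ^ (l ℕ.^ e) ≈ + 1 [mod M ]) → HasOrder M a (l ℕ.^ suc e)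
  prime^-order {M} {a} {l} pr e a^L≈1 a^l^e≉1 = hasOrder a^L≈1 minimal
    where
    L = l ℕ.^ suc e
    minimal : ∀ i → a ^ i ≈ + 1 [mod M ] → L ∣ℕ i
    minimal i a^i≈1 with divisor-of-prime^ pr (suc e) (gcd i L) (gcd[m,n]∣n i L)
    ... | j , j≤e+1 , g≡l^j with ℕP.m≤n⇒m<n∨m≡n j≤e+1
    ... | inj₂ refl     = subst (_∣ℕ i) g≡l^j (gcd[m,n]∣m i L)
    ... | inj₁ (s≤s j≤e) = ⊥-elim (a^l^e≉1 (≈1-multiple (l ℕ.^ e) (≈1-gcd i L a^i≈1 a^L≈1)
                                             (subst (_∣ℕ l ℕ.^ e) (sym g≡l^j) (^-monoʳ-∣ l j≤e))))

  order-* : ∀ {M a b u v} → HasOrder M a u → HasOrder M b v → Coprime u v → HasOrder M (a * b) (u ℕ.* v)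
  order-* {M} {a} {b} {u} {v} oa ob u⊥v = hasOrder ab^uv≈1 minimal
    where
    a^ui≈1 : ∀ i → a ^ (u ℕ.* i) ≈ + 1 [mod M ]
    a^ui≈1 i = ≈1-multiple (u ℕ.* i) (pow-order≈1 oa) (ℕD.m∣m*n {u} i)
    b^vi≈1 : ∀ i → b ^ (v ℕ.* i) ≈ + 1 [mod M ]
    b^vi≈1 i = ≈1-multiple (v ℕ.* i) (pow-order≈1 ob) (ℕD.m∣m*n {v} i)
    ab^uv≈1 : (a * b) ^ (u ℕ.* v) ≈ + 1 [mod M ]
    ab^uv≈1 = begin
      (a * b) ^ (u ℕ.* v)              ≡⟨ ^-distrib-* a b (u ℕ.* v) ⟩
      a ^ (u ℕ.* v) * b ^ (u ℕ.* v)    ≈⟨ ≈-* (a^ui≈1 v) (subst (λ k → b ^ k ≈ + 1 [mod M ]) (ℕP.*-comm v u) (b^vi≈1 u)) ⟩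
      + 1                              ∎
      where open ≈-Reasoning M
    -- (ab)^i ≡ 1 gives b^(ui) ≡ 1 and a^(vi) ≡ 1, hence v ∣ ui and u ∣ vi.
    minimal : ∀ i → (a * b) ^ i ≈ + 1 [mod M ] → u ℕ.* v ∣ℕ i
    minimal i ab^i≈1 = coprime-∣* u⊥v u∣i v∣i
      where
      ab^ik≈1 : ∀ k → a ^ (k ℕ.* i) * b ^ (k ℕ.* i) ≈ + 1 [mod M ]
      ab^ik≈1 k = ≈-trans (≈-reflexive (sym (^-distrib-* a b (k ℕ.* i)))) (≈1-multiple (k ℕ.* i) ab^i≈1 (ℕD.n∣m*n k))
      u∣i : u ∣ℕ i
      u∣i = NC.coprime-divisor u⊥v (order∣ oa (v ℕ.* i) (begin
        a ^ (v ℕ.* i)                        ≡⟨ ℤP.*-identityʳ _ ⟨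
        a ^ (v ℕ.* i) * + 1                  ≈⟨ ≈-*ˡ (a ^ (v ℕ.* i)) (b^vi≈1 i) ⟨
        a ^ (v ℕ.* i) * b ^ (v ℕ.* i)        ≈⟨ ab^ik≈1 v ⟩
        + 1                                  ∎))
        where open ≈-Reasoning M
      v∣i : v ∣ℕ i
      v∣i = NC.coprime-divisor (NC.sym u⊥v) (order∣ ob (u ℕ.* i) (begin
        b ^ (u ℕ.* i)                        ≡⟨ ℤP.*-identityˡ _ ⟨
        + 1 * b ^ (u ℕ.* i)                  ≈⟨ ≈-*ʳ (b ^ (u ℕ.* i)) (a^ui≈1 i) ⟨
        a ^ (u ℕ.* i) * b ^ (u ℕ.* i)        ≈⟨ ab^ik≈1 u ⟩
        + 1                                  ∎))
        where open ≈-Reasoning M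

  power-of-order : ∀ {M r e y} s → HasOrder M r e → y ≈ r ^ s [mod M ] → y ^ e ≈ + 1 [mod M ]
  power-of-order {M} {r} {e} {y} s o y≈r^s = begin
    y ^ e          ≈⟨ ≈-^ e y≈r^s ⟩
    (r ^ s) ^ e    ≡⟨ ^-*-comm r s e ⟩
    (r ^ e) ^ s    ≈⟨ ≈1-^ s (pow-order≈1 o) ⟩
    + 1            ∎
    where open ≈-Reasoning M

  order⇒prime∤ : ∀ {p} → Prime p → ∀ {M r e} → + p ∣ M → 0 ℕ.< e → HasOrder M r e → ¬ (+ p ∣ r)
  order⇒prime∤ {p} pr {M} {r} {suc e} p∣M _ o p∣r = prime∤1 pr (subst (+ p ∣_) (cancel r (r ^ e))
    (ℤD.∣m∣n⇒∣m-n (ℤD.∣m⇒∣m*n (r ^ e) p∣r) (ℤD.∣-trans p∣M (divides-difference (pow-order≈1 o)))))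
    where cancel : ∀ (a b : ℤ) → a * b - (a * b - + 1) ≡ + 1
          cancel = solve-∀

  -- Monic integer polynomials of degree d, given by their lower coefficients
  -- c₀ ∷ c₁ ∷ … ∷ c_{d-1} and evaluated in Horner form:
  --   monic (c₀ ∷ cs) x = c₀ + x · monic cs x,   monic [] x = 1.
  monic : ∀ {d} → Vec ℤ d → ℤ → ℤ
  monic []       x = + 1
  monic (c ∷ cs) x = c + x * monic cs x

  -- u(x) + a·v(x) for monic u of degree m+1 and monic v of degree m is again
  -- monic of degree m+1; these are its lower coefficients.
  plus-scaled : ∀ {m} → Vec ℤ (suc m) → ℤ → Vec ℤ m → Vec ℤ (suc m)
  plus-scaled (c ∷ [])      a []       = c + a ∷ []
  plus-scaled (c ∷ c′ ∷ cs) a (t ∷ ts) = c + a * t ∷ plus-scaled (c′ ∷ cs) a ts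

  monic-plus-scaled : ∀ {m} (u : Vec ℤ (suc m)) a (v : Vec ℤ m) x →
                     monic (plus-scaled u a v) x ≡ monic u x + a * monic v x
  monic-plus-scaled (c ∷ []) a [] x = regroup c a x
    where regroup : ∀ (c a x : ℤ) → c + a + x * + 1 ≡ c + x * + 1 + a * + 1
          regroup = solve-∀
  monic-plus-scaled (c ∷ c′ ∷ cs) a (t ∷ ts) x =
    trans (cong (λ s → c + a * t + x * s) (monic-plus-scaled (c′ ∷ cs) a ts x))
          (regroup c a t x (monic (c′ ∷ cs) x) (monic ts x))
    where regroup : ∀ (c a t x u v : ℤ) → c + a * t + x * (u + a * v) ≡ c + x * u + a * (t + x * v)
          regroup = solve-∀

  factor-theorem : ∀ {n} (r : Vec ℤ (suc n)) a → Σ (Vec ℤ n) λ s → ∀ x → monic r x - monic r a ≡ (x - a) * monic s x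
  factor-theorem (c ∷ []) a = [] , λ x → linear c x a
    where linear : ∀ (c x a : ℤ) → c + x * + 1 - (c + a * + 1) ≡ (x - a) * + 1
          linear = solve-∀
  factor-theorem (c ∷ cs@(_ ∷ _)) a with factor-theorem cs a
  ... | t , cs-factored = plus-scaled cs a t , λ x → begin
    c + x * monic cs x - (c + a * monic cs a)              ≡⟨ regroup c x a (monic cs x) (monic cs a) ⟩
    (x - a) * monic cs x + a * (monic cs x - monic cs a)   ≡⟨ cong (λ d → (x - a) * monic cs x + a * d) (cs-factored x) ⟩
    (x - a) * monic cs x + a * ((x - a) * monic t x)       ≡⟨ collect x a (monic cs x) (monic t x) ⟩
    (x - a) * (monic cs x + a * monic t x)                 ≡⟨ cong ((x - a) *_) (monic-plus-scaled cs a t x) ⟨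
    (x - a) * monic (plus-scaled cs a t) x                  ∎
    where
    open ≡-Reasoning
    regroup : ∀ (c x a u v : ℤ) → c + x * u - (c + a * v) ≡ (x - a) * u + a * (u - v)
    regroup = solve-∀
    collect : ∀ (x a u w : ℤ) → (x - a) * u + a * ((x - a) * w) ≡ (x - a) * (u + a * w)
    collect = solve-∀

  lagrange : ∀ {p} → Prime p → ∀ d (r : Vec ℤ d) (xs : Fin (suc d) → ℤ) →
             (∀ i j → i ≢ j → ¬ (+ p ∣ xs i - xs j)) → ¬ (∀ i → + p ∣ monic r (xs i))
  lagrange pr zero [] xs distinct roots = prime∤1 pr (roots F.zero)
  lagrange {p} pr (suc d) r xs distinct roots with factor-theorem r (xs F.zero)
  ... | s , r-factored = lagrange pr d s (λ i → xs (F.suc i)) distinct′ roots′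
    where
    distinct′ : ∀ i j → i ≢ j → ¬ (+ p ∣ xs (F.suc i) - xs (F.suc j))
    distinct′ i j i≢j = distinct (F.suc i) (F.suc j) (λ e → i≢j (FP.suc-injective e))
    roots′ : ∀ i → + p ∣ monic s (xs (F.suc i))
    roots′ i with euclidsLemmaℤ (xs (F.suc i) - xs F.zero) (monic s (xs (F.suc i))) pr
                   (subst (+ p ∣_) (r-factored (xs (F.suc i))) (ℤD.∣m∣n⇒∣m-n (roots (F.suc i)) (roots F.zero)))
    ... | inj₁ p∣difference = ⊥-elim (distinct (F.suc i) F.zero (λ ()) p∣difference)
    ... | inj₂ p∣root       = p∣root

  below-prime-∣-difference : ∀ {p a b} → b ℕ.≤ a → a ℕ.< p → + p ∣ + a - + b → a ℕ.≤ b
  below-prime-∣-difference {p} {a} {b} b≤a a<p d = ℕP.m∸n≡0⇒m≤n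
    (multiple-below (a ℕ.∸ b) (ℕP.≤-<-trans (ℕP.m∸n≤m a b) a<p)
                    (subst (p ∣ℕ_) (cong ∣_∣ (trans (ℤP.m-n≡m⊖n a b) (ℤP.⊖-≥ b≤a))) (ℤD.∣⇒∣ᵤ d)))
    where multiple-below : ∀ k → k ℕ.< p → p ∣ℕ k → k ≡ 0
          multiple-below zero    _   _   = refl
          multiple-below (suc k) k<p p∣k = ⊥-elim (ℕP.<⇒≱ k<p (ℕD.∣⇒≤ p∣k))

  below-prime-congruent : ∀ {p} a b → a ℕ.< p → b ℕ.< p → + p ∣ + a - + b → a ≡ b
  below-prime-congruent a b a<p b<p d with ℕP.≤-total b a
  ... | inj₁ b≤a = ℕP.≤-antisym (below-prime-∣-difference b≤a a<p d) b≤a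
  ... | inj₂ a≤b = sym (ℕP.≤-antisym (below-prime-∣-difference a≤b b<p (subst (_ ∣_) (negate (+ a) (+ b)) (ℤD.∣m⇒∣-m d))) a≤b)
    where negate : ∀ (a b : ℤ) → - (a - b) ≡ b - a
          negate = solve-∀

  power-minus-one : ∀ D → Vec ℤ (suc D)
  power-minus-one D = - + 1 ∷ replicate D (+ 0)

  monic-power-minus-one : ∀ D x → monic (power-minus-one D) x ≡ x ^ suc D - + 1
  monic-power-minus-one D x = trans (cong (λ t → - + 1 + x * t) (monomial D)) (ℤP.+-comm (- + 1) (x ^ suc D))
    where monomial : ∀ k → monic (replicate k (+ 0)) x ≡ x ^ k
          monomial zero    = refl
          monomial (suc k) = trans (ℤP.+-identityˡ _) (cong (x *_) (monomial k))

  -- For 0 < D and D + 1 < p, some x among 1, …, D+1 (so p ∤ x) has x^D ≢ 1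
  -- modulo p: otherwise x^D - 1 would have D + 1 roots.
  non-root-exists : ∀ {p} → Prime p → ∀ D → 0 ℕ.< D → suc D ℕ.< p →
                    Σ ℤ λ x → ¬ (+ p ∣ x) × ¬ (x ^ D ≈ + 1 [mod + p ])
  non-root-exists {p} pr (suc D) _ D+1<p with FP.¬∀⟶∃¬ (suc (suc D)) IsRoot is-root? all-roots-impossible
    where
    point : Fin (suc (suc D)) → ℤ
    point i = + suc (toℕ i)
    IsRoot : Fin (suc (suc D)) → Set
    IsRoot i = point i ^ suc D ≈ + 1 [mod + p ]
    is-root? : ∀ i → Dec (IsRoot i)
    is-root? i with + p ℤD.∣? (point i ^ suc D - + 1)
    ... | yes d = yes (congruent d)
    ... | no ¬d = no (λ c → ¬d (divides-difference c))
    point<p : ∀ i → suc (toℕ i) ℕ.< p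
    point<p i = ℕP.≤-<-trans (FP.toℕ<n i) D+1<p
    all-roots-impossible : ¬ (∀ i → IsRoot i)
    all-roots-impossible all = lagrange pr (suc D) (power-minus-one D) point distinct roots
      where
      distinct : ∀ i j → i ≢ j → ¬ (+ p ∣ point i - point j)
      distinct i j i≢j d = i≢j (FP.toℕ-injective (ℕP.suc-injective
                            (below-prime-congruent (suc (toℕ i)) (suc (toℕ j)) (point<p i) (point<p j) d)))
      roots : ∀ i → + p ∣ monic (power-minus-one D) (point i)
      roots i = subst (+ p ∣_) (sym (monic-power-minus-one D (point i))) (divides-difference (all i))
  ... | i , not-root = + suc (toℕ i) , p∤point , not-root
    where p∤point : ¬ (+ p ∣ + suc (toℕ i))
          p∤point d = ℕP.<⇒≱ (ℕP.≤-<-trans (FP.toℕ<n i) D+1<p) (ℕD.∣⇒≤ (ℤD.∣⇒∣ᵤ d))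

  prime-factor : ∀ d → 2 ℕ.≤ d → Σ ℕ λ l → Prime l × l ∣ℕ d
  prime-factor d 2≤d with factorise d {{ℕ.>-nonZero (ℕP.<-trans (s≤s z≤n) 2≤d)}}
  ... | record { factors = [] ; isFactorisation = d≡1 } = ⊥-elim (ℕP.<⇒≢ 2≤d (sym d≡1))
  ... | record { factors = l ∷ ls ; isFactorisation = d≡ ; factorsPrime = l-prime ∷ _ } =
    l , l-prime , ℕD.divides (product ls) (trans d≡ (ℕP.*-comm l _))

  split-prime-power : ∀ {l} → Prime l → ∀ d → 0 ℕ.< d → Σ ℕ λ e → Σ ℕ λ d′ → d ≡ l ℕ.^ e ℕ.* d′ × ¬ (l ∣ℕ d′)
  split-prime-power {l} pr = <-rec Split step
    where
    Split : ℕ → Set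
    Split d = 0 ℕ.< d → Σ ℕ λ e → Σ ℕ λ d′ → d ≡ l ℕ.^ e ℕ.* d′ × ¬ (l ∣ℕ d′)
    step : ∀ d → (∀ {c} → c ℕ.< d → Split c) → Split d
    step d rec 0<d with l ℕD.∣? d
    ... | no l∤d = 0 , d , sym (ℕP.+-identityʳ d) , l∤d
    ... | yes (ℕD.divides c d≡cl) with rec c<d 0<c
      where
      0<c : 0 ℕ.< c
      0<c = ℕP.n≢0⇒n>0 (λ { refl → ℕP.<⇒≢ 0<d (sym d≡cl) })
      c<d : c ℕ.< d
      c<d = subst (c ℕ.<_) (sym d≡cl) (ℕP.m<m*n c l {{ℕ.>-nonZero 0<c}} (prime>1 pr))
    ... | e , d′ , c≡ , l∤d′ = suc e , d′ , (begin
      d                           ≡⟨ d≡cl ⟩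
      c ℕ.* l                     ≡⟨ cong (ℕ._* l) c≡ ⟩
      l ℕ.^ e ℕ.* d′ ℕ.* l        ≡⟨ rotate (l ℕ.^ e) d′ l ⟩
      l ℕ.* l ℕ.^ e ℕ.* d′        ∎) , l∤d′
      where
      open ≡-Reasoning
      rotate : ∀ a b c → a ℕ.* b ℕ.* c ≡ c ℕ.* a ℕ.* b
      rotate = ℕSolver.solve-∀

  -- If l^(e+1) ∣ p - 1 there is an element of order l^(e+1) modulo p.  Write
  -- p - 1 = l^(e+1)·w and D = l^e·w = (p-1)/l; take x with x^D ≢ 1 and c = x^w.
  -- Then c^(l^(e+1)) = x^(p-1) ≡ 1 by Fermat while c^(l^e) = x^D ≢ 1.
  element-of-prime^-order : ∀ {p l} → Prime p → Prime l → ∀ e → l ℕ.^ suc e ∣ℕ p ℕ.∸ 1 →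
                            Σ ℤ λ c → HasOrder (+ p) c (l ℕ.^ suc e)
  element-of-prime^-order {p} {l} pr pl e (ℕD.divides w p-1≡wL)
    with non-root-exists pr D 0<D D+1<p
    where
    D = l ℕ.^ e ℕ.* w
    p-1≡lD : p ℕ.∸ 1 ≡ l ℕ.* D
    p-1≡lD = trans p-1≡wL (trans (ℕP.*-comm w (l ℕ.^ suc e)) (ℕP.*-assoc l (l ℕ.^ e) w))
    0<p-1 : 0 ℕ.< p ℕ.∸ 1
    0<p-1 = ℕP.m<n⇒0<n∸m (prime>1 pr)
    0<D : 0 ℕ.< D
    0<D = ℕP.n≢0⇒n>0 (λ D≡0 → ℕP.<⇒≢ 0<p-1 (sym (trans p-1≡lD (trans (cong (l ℕ.*_) D≡0) (ℕP.*-zeroʳ l)))))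
    D+1<p : suc D ℕ.< p
    D+1<p = below-pred (subst (D ℕ.<_) (trans (ℕP.*-comm D l) (sym p-1≡lD)) (ℕP.m<m*n D l {{ℕ.>-nonZero 0<D}} (prime>1 pl)))
      where below-pred : ∀ {m n} → m ℕ.< n ℕ.∸ 1 → suc m ℕ.< n
            below-pred {n = suc n} m<n = s≤s m<n
  ... | x , p∤x , x^D≉1 = x ^ w , prime^-order pl e c^L≈1 c^l^e≉1
    where
    c^L≈1 : (x ^ w) ^ (l ℕ.^ suc e) ≈ + 1 [mod + p ]
    c^L≈1 = subst (λ t → t ≈ + 1 [mod + p ]) (trans (cong (x ^_) p-1≡wL) (^-* x w (l ℕ.^ suc e))) (fermat-unit pr x p∤x)
    c^l^e≉1 : ¬ ((x ^ w) ^ (l ℕ.^ e) ≈ + 1 [mod + p ])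
    c^l^e≉1 c≈1 = x^D≉1 (subst (λ t → t ≈ + 1 [mod + p ]) (trans (sym (^-* x w (l ℕ.^ e))) (cong (x ^_) (ℕP.*-comm w (l ℕ.^ e)))) c≈1)

  -- For every d ∣ p - 1 there is an element of order d modulo p, by strong
  -- induction on d: split d = l^(e+1)·d′ with l ∤ d′ and multiply an element of
  -- order d′ with one of order l^(e+1).  In particular primitive roots exist.
  element-of-order : ∀ {p} → Prime p → ∀ d → d ∣ℕ p ℕ.∸ 1 → Σ ℤ λ a → HasOrder (+ p) a d
  element-of-order {p} pr = <-rec Goal step
    where
    Goal : ℕ → Set
    Goal d = d ∣ℕ p ℕ.∸ 1 → Σ ℤ λ a → HasOrder (+ p) a d
    step : ∀ d → (∀ {c} → c ℕ.< d → Goal c) → Goal d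
    step zero _ 0∣p-1 = ⊥-elim (ℕP.<⇒≢ (ℕP.m<n⇒0<n∸m (prime>1 pr)) (sym (ℕD.0∣⇒≡0 0∣p-1)))
    step (suc zero) _ _ = + 1 , hasOrder (≈-refl _) (λ i _ → ℕD.1∣ i)
    step d@(suc (suc _)) rec d∣p-1 with prime-factor d (s≤s (s≤s z≤n))
    ... | l , pl , l∣d with split-prime-power pl d (s≤s z≤n)
    ... | zero , d′ , d≡ , l∤d′ = ⊥-elim (l∤d′ (subst (l ∣ℕ_) (trans d≡ (ℕP.*-identityˡ d′)) l∣d))
    ... | suc e , d′ , d≡ , l∤d′ = a * c , subst (HasOrder (+ p) (a * c)) (trans (ℕP.*-comm d′ L) (sym d≡)) (order-* oa oc d′⊥L)
      where
      L = l ℕ.^ suc e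
      L∣p-1 : L ∣ℕ p ℕ.∸ 1
      L∣p-1 = ℕD.∣-trans (ℕD.divides d′ (trans d≡ (ℕP.*-comm L d′))) d∣p-1
      0<d′ : 0 ℕ.< d′
      0<d′ = ℕP.n≢0⇒n>0 (λ { refl → ℕP.<⇒≢ (s≤s z≤n) (sym (trans d≡ (ℕP.*-zeroʳ L))) })
      1<L : 1 ℕ.< L
      1<L = ℕP.<-≤-trans (prime>1 pl) (ℕP.m≤m*n l (l ℕ.^ e) {{ℕP.m^n≢0 l e {{prime⇒nonZero pl}}}})
      d′<d : d′ ℕ.< d
      d′<d = subst (d′ ℕ.<_) (trans (ℕP.*-comm d′ L) (sym d≡)) (ℕP.m<m*n d′ L {{ℕ.>-nonZero 0<d′}} 1<L)
      d′∣p-1 : d′ ∣ℕ p ℕ.∸ 1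
      d′∣p-1 = ℕD.∣-trans (ℕD.divides L d≡) d∣p-1
      a = proj₁ (rec d′<d d′∣p-1)
      oa : HasOrder (+ p) a d′
      oa = proj₂ (rec d′<d d′∣p-1)
      c = proj₁ (element-of-prime^-order pr pl e L∣p-1)
      oc : HasOrder (+ p) c L
      oc = proj₂ (element-of-prime^-order pr pl e L∣p-1)
      d′⊥L : Coprime d′ L
      d′⊥L = NC.sym (prime^-coprime pl l∤d′ (suc e))

  binomial-second-order : ∀ n y → Σ ℤ λ R → (+ 1 + y) ^ n ≡ + 1 + + n * y + + (n C 2) * (y * y) + y * y * y * R
  binomial-second-order zero y = + 0 , constant y
    where constant : ∀ (y : ℤ) → + 1 ≡ + 1 + + 0 * y + + 0 * (y * y) + y * y * y * + 0
          constant = solve-∀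
  binomial-second-order (suc n) y with binomial-second-order n y
  ... | R , expansion = + (n C 2) + R + y * R , (begin
    (+ 1 + y) * (+ 1 + y) ^ n
      ≡⟨ cong ((+ 1 + y) *_) expansion ⟩
    (+ 1 + y) * (+ 1 + + n * y + + (n C 2) * (y * y) + y * y * y * R)
      ≡⟨ multiply-out (+ n) (+ (n C 2)) y R ⟩
    + 1 + (+ 1 + + n) * y + (+ (n C 2) + + n) * (y * y) + y * y * y * (+ (n C 2) + R + y * R)
      ≡⟨ cong₂ (λ a b → + 1 + a * y + b * (y * y) + y * y * y * (+ (n C 2) + R + y * R))
               (ℤP.pos-+ 1 n) (trans (sym (ℤP.pos-+ (n C 2) n)) (cong +_ next-coefficient)) ⟩
    + 1 + + suc n * y + + (suc n C 2) * (y * y) + y * y * y * (+ (n C 2) + R + y * R) ∎)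
    where
    open ≡-Reasoning
    multiply-out : ∀ (a b y R : ℤ) → (+ 1 + y) * (+ 1 + a * y + b * (y * y) + y * y * y * R) ≡
                   + 1 + (+ 1 + a) * y + (b + a) * (y * y) + y * y * y * (b + R + y * R)
    multiply-out = solve-∀
    next-coefficient : n C 2 ℕ.+ n ≡ suc n C 2
    next-coefficient = trans (ℕP.+-comm (n C 2) n) (trans (cong (ℕ._+ n C 2) (sym (nC1≡n n))) (sym (pascal n 1)))

  choose-2-odd : ∀ h → (1 ℕ.+ 2 ℕ.* h) C 2 ≡ (1 ℕ.+ 2 ℕ.* h) ℕ.* h
  choose-2-odd zero    = refl
  choose-2-odd (suc h) = begin
    (1 ℕ.+ 2 ℕ.* suc h) C 2                               ≡⟨ cong (_C 2) (two-steps h) ⟩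
    suc (suc n) C 2                                       ≡⟨ pascal (suc n) 1 ⟩
    suc n C 1 ℕ.+ suc n C 2                               ≡⟨ cong₂ ℕ._+_ (nC1≡n (suc n)) (pascal n 1) ⟩
    suc n ℕ.+ (n C 1 ℕ.+ n C 2)                           ≡⟨ cong (λ t → suc n ℕ.+ (t ℕ.+ n C 2)) (nC1≡n n) ⟩
    suc n ℕ.+ (n ℕ.+ n C 2)                               ≡⟨ cong (λ t → suc n ℕ.+ (n ℕ.+ t)) (choose-2-odd h) ⟩
    suc n ℕ.+ (n ℕ.+ n ℕ.* h)                             ≡⟨ arithmetic h ⟩
    (1 ℕ.+ 2 ℕ.* suc h) ℕ.* suc h                         ∎
    where
    open ≡-Reasoning
    n = 1 ℕ.+ 2 ℕ.* h
    two-steps : ∀ h → 1 ℕ.+ 2 ℕ.* suc h ≡ suc (suc (1 ℕ.+ 2 ℕ.* h))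
    two-steps h = cong suc (ℕP.*-suc 2 h)
    arithmetic : ∀ h → suc (1 ℕ.+ 2 ℕ.* h) ℕ.+ (1 ℕ.+ 2 ℕ.* h ℕ.+ (1 ℕ.+ 2 ℕ.* h) ℕ.* h) ≡ (1 ℕ.+ 2 ℕ.* suc h) ℕ.* suc h
    arithmetic = ℕSolver.solve-∀

  ≈1⇒ : ∀ {M x} → x ≈ + 1 [mod M ] → Σ ℤ λ v → x ≡ + 1 + M * v
  ≈1⇒ {M} {x} (congruent (ℤD.divides v x-1≡vM)) = v , trans (shift x) (cong (λ t → + 1 + t) (trans x-1≡vM (ℤP.*-comm v M)))
    where shift : ∀ (x : ℤ) → x ≡ + 1 + (x - + 1)
          shift = solve-∀

  ⇒≈1 : ∀ M v → + 1 + M * v ≈ + 1 [mod M ]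
  ⇒≈1 M v = congruent (ℤD.divides v (trans (cancel M v) (ℤP.*-comm M v)))
    where cancel : ∀ (M v : ℤ) → + 1 + M * v - + 1 ≡ M * v
          cancel = solve-∀

  -- Powers of an odd prime p: the group of units modulo p^(α+1) is cyclic.
  module OddPrimePower {p : ℕ} (pr : Prime p) (p≢2 : p ≢ 2) where

    P : ℤ
    P = + p

    -- (1 + p·z)^p = 1 + p²·z·(1 + p·w): the second-order binomial term
    -- C(p,2)·p²z² is divisible by p³ because p is odd.
    lift-step : ∀ z → Σ ℤ λ w → (+ 1 + P * z) ^ p ≡ + 1 + P * P * z * (+ 1 + P * w)
    lift-step z with binomial-second-order p (P * z)
    ... | R , expansion = + h * z + z * z * R , (begin
      (+ 1 + P * z) ^ p
        ≡⟨ expansion ⟩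
      + 1 + P * (P * z) + + (p C 2) * (P * z * (P * z)) + P * z * (P * z) * (P * z) * R
        ≡⟨ cong (λ c → + 1 + P * (P * z) + c * (P * z * (P * z)) + P * z * (P * z) * (P * z) * R) C[p,2]≡ph ⟩
      + 1 + P * (P * z) + P * + h * (P * z * (P * z)) + P * z * (P * z) * (P * z) * R
        ≡⟨ factor P (+ h) z R ⟩
      + 1 + P * P * z * (+ 1 + P * (+ h * z + z * z * R))      ∎)
      where
      open ≡-Reasoning
      h = proj₁ (odd-prime pr p≢2)
      C[p,2]≡ph : + (p C 2) ≡ P * + h
      C[p,2]≡ph = trans (cong +_ (subst (λ q → q C 2 ≡ q ℕ.* h) (sym (proj₂ (odd-prime pr p≢2))) (choose-2-odd h)))
                        (ℤP.pos-* p h)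
      factor : ∀ (P H z R : ℤ) → + 1 + P * (P * z) + P * H * (P * z * (P * z)) + P * z * (P * z) * (P * z) * R ≡
               + 1 + P * P * z * (+ 1 + P * (H * z + z * z * R))
      factor = solve-∀

    lift-power : ∀ j u → Σ ℤ λ w → (+ 1 + P ^ suc j * u) ^ p ≡ + 1 + P ^ suc (suc j) * (u * (+ 1 + P * w))
    lift-power j u = let (w , step) = lift-step (P ^ j * u) in w , (begin
      (+ 1 + P ^ suc j * u) ^ p                   ≡⟨ cong (λ t → (+ 1 + t) ^ p) (ℤP.*-assoc P (P ^ j) u) ⟩
      (+ 1 + P * (P ^ j * u)) ^ p                 ≡⟨ step ⟩
      + 1 + P * P * (P ^ j * u) * (+ 1 + P * w)   ≡⟨ regroup P (P ^ j) u w ⟩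
      + 1 + P ^ suc (suc j) * (u * (+ 1 + P * w)) ∎)
      where
      open ≡-Reasoning
      regroup : ∀ (P A u w : ℤ) → + 1 + P * P * (A * u) * (+ 1 + P * w) ≡ + 1 + P * (P * A) * (u * (+ 1 + P * w))
      regroup = solve-∀

    p∤1+pw : ∀ w → ¬ (P ∣ + 1 + P * w)
    p∤1+pw w d = prime∤1 pr (subst (P ∣_) (cancel w P) (ℤD.∣m∣n⇒∣m-n d (ℤD.∣n⇒∣m*n w (ℤD.∣-refl {P}))))
      where cancel : ∀ (w P : ℤ) → + 1 + P * w - w * P ≡ + 1
            cancel = solve-∀

    power-lift : ∀ x k → x ≈ + 1 [mod P ] → x ^ (p ℕ.^ k) ≈ + 1 [mod P ^ suc k ]
    power-lift x zero x≈1 = ≈-trans (≈-reflexive (ℤP.*-identityʳ x)) (≈-modulus (sym (ℤP.*-identityʳ P)) x≈1)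
    power-lift x (suc k) x≈1 =
      let (v , x^p^k≡) = ≈1⇒ (power-lift x k x≈1)
          (w , lifted) = lift-power k v
      in ≈-trans (≈-reflexive (begin
      x ^ (p ℕ.* p ℕ.^ k)       ≡⟨ cong (x ^_) (ℕP.*-comm p (p ℕ.^ k)) ⟩
      x ^ (p ℕ.^ k ℕ.* p)       ≡⟨ ^-* x (p ℕ.^ k) p ⟩
      (x ^ (p ℕ.^ k)) ^ p       ≡⟨ cong (_^ p) x^p^k≡ ⟩
      (+ 1 + P ^ suc k * v) ^ p ≡⟨ lifted ⟩
      + 1 + P ^ suc (suc k) * (v * (+ 1 + P * w)) ∎)) (⇒≈1 _ _)
      where open ≡-Reasoning

    one-plus-p-power : ∀ j → Σ ℤ λ u → (+ 1 + P) ^ (p ℕ.^ j) ≡ + 1 + P ^ suc j * u × ¬ (P ∣ u)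
    one-plus-p-power zero = + 1 , first-power P , prime∤1 pr
      where first-power : ∀ (P : ℤ) → (+ 1 + P) * + 1 ≡ + 1 + P * + 1 * + 1
            first-power = solve-∀
    one-plus-p-power (suc j) =
      let (u , power≡ , p∤u) = one-plus-p-power j
          (w , lifted) = lift-power j u
      in u * (+ 1 + P * w) , (begin
      (+ 1 + P) ^ (p ℕ.* p ℕ.^ j)     ≡⟨ cong ((+ 1 + P) ^_) (ℕP.*-comm p (p ℕ.^ j)) ⟩
      (+ 1 + P) ^ (p ℕ.^ j ℕ.* p)     ≡⟨ ^-* (+ 1 + P) (p ℕ.^ j) p ⟩
      ((+ 1 + P) ^ (p ℕ.^ j)) ^ p     ≡⟨ cong (_^ p) power≡ ⟩
      (+ 1 + P ^ suc j * u) ^ p       ≡⟨ lifted ⟩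
      + 1 + P ^ suc (suc j) * (u * (+ 1 + P * w)) ∎) , prime∤* pr p∤u (p∤1+pw w)
      where open ≡-Reasoning

    order-one-plus-p : ∀ α → HasOrder (+ (p ℕ.^ suc α)) (+ 1 + P) (p ℕ.^ α)
    order-one-plus-p zero = hasOrder (≈-modulus (cong +_ (sym (ℕP.*-identityʳ p))) (≈-trans (≈-reflexive (first-power P)) (⇒≈1 P (+ 1))))
                                     (λ i _ → ℕD.1∣ i)
      where first-power : ∀ (P : ℤ) → (+ 1 + P) * + 1 ≡ + 1 + P * + 1
            first-power = solve-∀
    order-one-plus-p (suc β) = prime^-order pr β power≈1 power≉1
      where
      M≡ : + (p ℕ.^ suc (suc β)) ≡ P ^ suc (suc β)
      M≡ = pos-^ p (suc (suc β))
      power≈1 : (+ 1 + P) ^ (p ℕ.^ suc β) ≈ + 1 [mod + (p ℕ.^ suc (suc β)) ]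
      power≈1 = let (u , power≡ , _) = one-plus-p-power (suc β) in ≈-modulus (sym M≡) (≈-trans (≈-reflexive power≡) (⇒≈1 _ u))
      power≉1 : ¬ ((+ 1 + P) ^ (p ℕ.^ β) ≈ + 1 [mod + (p ℕ.^ suc (suc β)) ])
      power≉1 c = p∤u (ℤD.*-cancelˡ-∣ (P ^ suc β) {{nonZero}} (subst₂ _∣_ M≡′ (difference power≡) (divides-difference c)))
        where
        u = proj₁ (one-plus-p-power β)
        power≡ : (+ 1 + P) ^ (p ℕ.^ β) ≡ + 1 + P ^ suc β * u
        power≡ = proj₁ (proj₂ (one-plus-p-power β))
        p∤u : ¬ (P ∣ u)
        p∤u = proj₂ (proj₂ (one-plus-p-power β))
        nonZero : ℤ.NonZero (P ^ suc β)
        nonZero = subst ℤ.NonZero (pos-^ p (suc β)) (ℕP.m^n≢0 p (suc β) {{prime⇒nonZero pr}})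
        M≡′ : + (p ℕ.^ suc (suc β)) ≡ P ^ suc β * P
        M≡′ = trans M≡ (ℤP.*-comm P (P ^ suc β))
        difference : ∀ {x} → x ≡ + 1 + P ^ suc β * u → x - + 1 ≡ P ^ suc β * u
        difference refl = cancel (P ^ suc β) u
          where cancel : ∀ (A u : ℤ) → + 1 + A * u - + 1 ≡ A * u
                cancel = solve-∀

    -- A primitive root modulo p^(α+1): the product of a^(p^α), where a is a
    -- primitive root modulo p, which has order p - 1, and 1 + p, of order p^α.
    primitive-root : ∀ α → Σ ℤ λ r → HasOrder (+ (p ℕ.^ suc α)) r ((p ℕ.∸ 1) ℕ.* p ℕ.^ α)
    primitive-root α = a ^ (p ℕ.^ α) * (+ 1 + P) , order-* order-p-1 (order-one-plus-p α) (NC.sym p^α⊥p-1)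
      where
      M = + (p ℕ.^ suc α)
      a = proj₁ (element-of-order pr (p ℕ.∸ 1) ℕD.∣-refl)
      order-a : HasOrder P a (p ℕ.∸ 1)
      order-a = proj₂ (element-of-order pr (p ℕ.∸ 1) ℕD.∣-refl)
      p^α⊥p-1 : Coprime (p ℕ.^ α) (p ℕ.∸ 1)
      p^α⊥p-1 = prime^-coprime pr p∤p-1 α
        where p∤p-1 : ¬ (p ∣ℕ p ℕ.∸ 1)
              p∤p-1 p∣p-1 = ℕP.<⇒≱ (ℕP.∸-monoʳ-< (s≤s z≤n) (ℕP.<⇒≤ (prime>1 pr)))
                                   (ℕD.∣⇒≤ {{ℕ.>-nonZero (ℕP.m<n⇒0<n∸m (prime>1 pr))}} p∣p-1)
      p∣M : P ∣ M
      p∣M = ℤD.divides (+ (p ℕ.^ α)) (trans (ℤP.pos-* p (p ℕ.^ α)) (ℤP.*-comm P _))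
      order-p-1 : HasOrder M (a ^ (p ℕ.^ α)) (p ℕ.∸ 1)
      order-p-1 = hasOrder power≈1 minimal
        where
        power≈1 : (a ^ (p ℕ.^ α)) ^ (p ℕ.∸ 1) ≈ + 1 [mod M ]
        power≈1 = subst (λ t → t ≈ + 1 [mod M ]) (^-*-comm a (p ℕ.∸ 1) (p ℕ.^ α))
                        (≈-modulus (sym (pos-^ p (suc α))) (power-lift (a ^ (p ℕ.∸ 1)) α (pow-order≈1 order-a)))
        minimal : ∀ i → (a ^ (p ℕ.^ α)) ^ i ≈ + 1 [mod M ] → p ℕ.∸ 1 ∣ℕ i
        minimal i c = NC.coprime-divisor (NC.sym p^α⊥p-1)
                        (order∣ order-a _ (subst (λ t → t ≈ + 1 [mod P ]) (sym (^-* a (p ℕ.^ α) i)) (≈-divisor p∣M c)))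

  mixed-radix-unique : ∀ n q q′ a a′ → a ℕ.< n → a′ ℕ.< n → q ℕ.* n ℕ.+ a ≡ q′ ℕ.* n ℕ.+ a′ → q ≡ q′ × a ≡ a′
  mixed-radix-unique n q q′ a a′ a<n a′<n e = q≡q′ , a≡a′
    where
    instance _ = ℕ.>-nonZero (ℕP.≤-<-trans z≤n a<n)
    low-digit : ∀ q a → a ℕ.< n → (q ℕ.* n ℕ.+ a) % n ≡ a
    low-digit q a a<n = trans (cong (_% n) (ℕP.+-comm (q ℕ.* n) a)) (trans ([m+kn]%n≡m%n a q n) (m<n⇒m%n≡m a<n))
    a≡a′ : a ≡ a′
    a≡a′ = trans (sym (low-digit q a a<n)) (trans (cong (_% n) e) (low-digit q′ a′ a′<n))
    q≡q′ : q ≡ q′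
    q≡q′ = ℕP.*-cancelʳ-≡ q q′ n (ℕP.+-cancelʳ-≡ a (q ℕ.* n) (q′ ℕ.* n) (trans e (cong (q′ ℕ.* n ℕ.+_) (sym a≡a′))))

  -- The units are
  -- coded injectively into {0, …, φM-1}; among the φM+1 values y, r^0, …,
  -- r^(φM-1) two codes coincide, and the powers of r are pairwise incongruent.
  module DiscreteLogarithm {p : ℕ} (pr : Prime p) (α : ℕ) where

    M : ℕ
    M = p ℕ.^ suc α

    instance
      p≢0 : ℕ.NonZero p
      p≢0 = prime⇒nonZero pr
      M≢0 : ℕ.NonZero M
      M≢0 = ℕP.m^n≢0 p (suc α)

    residue digit high : ℤ → ℕ
    residue z = z ℤDM.% + M
    digit z = residue z % p
    high z = residue z / p

    residue≡ : ∀ z → residue z ≡ digit z ℕ.+ high z ℕ.* p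
    residue≡ z = m≡m%n+[m/n]*n (residue z) p

    digit≢0 : ∀ z → ¬ (+ p ∣ z) → digit z ≢ 0
    digit≢0 z p∤z digit≡0 = p∤z (subst (+ p ∣_) (sym (ℤDM.a≡a%n+[a/n]*n z (+ M)))
      (ℤD.∣m∣n⇒∣m+n (ℤD.∣ᵤ⇒∣ {i = + residue z} (ℕD.divides (high z) (trans (residue≡ z) (cong (ℕ._+ high z ℕ.* p) digit≡0))))
                    (ℤD.∣n⇒∣m*n (z ℤDM./ + M) p∣M)))
      where p∣M : + p ∣ + M
            p∣M = ℤD.∣ᵤ⇒∣ (ℕD.divides (p ℕ.^ α) (ℕP.*-comm p (p ℕ.^ α)))

    high<p^α : ∀ z → high z ℕ.< p ℕ.^ α
    high<p^α z = ℕP.*-cancelʳ-< p (high z) (p ℕ.^ α)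
      (ℕP.≤-<-trans (ℕP.≤-trans (ℕP.m≤n+m (high z ℕ.* p) (digit z)) (ℕP.≤-reflexive (sym (residue≡ z))))
                    (subst (residue z ℕ.<_) (ℕP.*-comm p (p ℕ.^ α)) (ℤDM.n%d<d z (+ M))))

    code : ℤ → ℕ
    code z = high z ℕ.* (p ℕ.∸ 1) ℕ.+ (digit z ℕ.∸ 1)

    digit-1< : ∀ z → ¬ (+ p ∣ z) → digit z ℕ.∸ 1 ℕ.< p ℕ.∸ 1
    digit-1< z p∤z = ℕP.∸-monoˡ-< (m%n<n (residue z) p) (ℕP.n≢0⇒n>0 (digit≢0 z p∤z))

    code< : ∀ z → ¬ (+ p ∣ z) → code z ℕ.< (p ℕ.∸ 1) ℕ.* p ℕ.^ α
    code< z p∤z = begin-strict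
      high z ℕ.* (p ℕ.∸ 1) ℕ.+ (digit z ℕ.∸ 1)    <⟨ ℕP.+-monoʳ-< (high z ℕ.* (p ℕ.∸ 1)) (digit-1< z p∤z) ⟩
      high z ℕ.* (p ℕ.∸ 1) ℕ.+ (p ℕ.∸ 1)          ≡⟨ ℕP.+-comm (high z ℕ.* (p ℕ.∸ 1)) (p ℕ.∸ 1) ⟩
      suc (high z) ℕ.* (p ℕ.∸ 1)                  ≤⟨ ℕP.*-monoˡ-≤ (p ℕ.∸ 1) (high<p^α z) ⟩
      p ℕ.^ α ℕ.* (p ℕ.∸ 1)                       ≡⟨ ℕP.*-comm (p ℕ.^ α) (p ℕ.∸ 1) ⟩
      (p ℕ.∸ 1) ℕ.* p ℕ.^ α                       ∎
      where open ℕP.≤-Reasoning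

    code-injective : ∀ z z′ → ¬ (+ p ∣ z) → ¬ (+ p ∣ z′) → code z ≡ code z′ → z ≈ z′ [mod + M ]
    code-injective z z′ p∤z p∤z′ e = congruent (ℤD.divides (q - q′) (begin
      z - z′                                    ≡⟨ cong₂ _-_ (ℤDM.a≡a%n+[a/n]*n z (+ M)) (ℤDM.a≡a%n+[a/n]*n z′ (+ M)) ⟩
      (+ residue z + q * + M) - (+ residue z′ + q′ * + M)
                                                ≡⟨ cong (λ w → (+ w + q * + M) - (+ residue z′ + q′ * + M)) same-residue ⟩
      (+ residue z′ + q * + M) - (+ residue z′ + q′ * + M)
                                                ≡⟨ cancel (+ residue z′) q q′ (+ M) ⟩
      (q - q′) * + M                            ∎))
      where
      open ≡-Reasoning
      q q′ : ℤ
      q  = z ℤDM./ + M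
      q′ = z′ ℤDM./ + M
      cancel : ∀ (a b c m : ℤ) → (a + b * m) - (a + c * m) ≡ (b - c) * m
      cancel = solve-∀
      digits : high z ≡ high z′ × digit z ℕ.∸ 1 ≡ digit z′ ℕ.∸ 1
      digits = mixed-radix-unique (p ℕ.∸ 1) (high z) (high z′) _ _ (digit-1< z p∤z) (digit-1< z′ p∤z′) e
      digit≡ : ∀ z → ¬ (+ p ∣ z) → digit z ≡ suc (digit z ℕ.∸ 1)
      digit≡ z p∤z = sym (ℕP.suc-pred (digit z) {{ℕ.≢-nonZero (digit≢0 z p∤z)}})
      same-digit : digit z ≡ digit z′
      same-digit = trans (digit≡ z p∤z) (trans (cong suc (proj₂ digits)) (sym (digit≡ z′ p∤z′)))
      same-residue : residue z ≡ residue z′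
      same-residue = begin
        residue z                      ≡⟨ residue≡ z ⟩
        digit z ℕ.+ high z ℕ.* p       ≡⟨ cong₂ (λ d h → d ℕ.+ h ℕ.* p) same-digit (proj₁ digits) ⟩
        digit z′ ℕ.+ high z′ ℕ.* p     ≡⟨ residue≡ z′ ⟨
        residue z′                     ∎

    φM : ℕ
    φM = (p ℕ.∸ 1) ℕ.* p ℕ.^ α

    0<φM : 0 ℕ.< φM
    0<φM = ℕ.>-nonZero⁻¹ φM {{ℕP.m*n≢0 (p ℕ.∸ 1) (p ℕ.^ α) {{ℕ.>-nonZero (ℕP.m<n⇒0<n∸m (prime>1 pr))}} {{ℕP.m^n≢0 p α}}}}

    p∣M : + p ∣ + M
    p∣M = ℤD.∣ᵤ⇒∣ (ℕD.divides (p ℕ.^ α) (ℕP.*-comm p (p ℕ.^ α)))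

    -- The powers r^0, …, r^(φM-1) of an element of order φM are pairwise incongruent:
    -- r^i ≡ r^j with i < j would give r^(j-i) ≡ 1 (cancelling the unit r^i).
    powers-distinct : ∀ {r} → HasOrder (+ M) r φM → ∀ i j → i ℕ.< j → j ℕ.< φM → ¬ (r ^ i ≈ r ^ j [mod + M ])
    powers-distinct {r} o i j i<j j<φM c =
      ℕP.<⇒≱ (ℕP.≤-<-trans (ℕP.m∸n≤m j i) j<φM) (ℕD.∣⇒≤ {{ℕ.>-nonZero (ℕP.m<n⇒0<n∸m i<j)}} φM∣j-i)
      where
      p∤r : ¬ (+ p ∣ r)
      p∤r = order⇒prime∤ pr p∣M 0<φM o
      factored : + M ∣ r ^ i * (r ^ (j ℕ.∸ i) - + 1)
      factored = subst (+ M ∣_) (trans (cong (λ t → - (r ^ i - t)) (trans (cong (r ^_) (sym (ℕP.m+[n∸m]≡n (ℕP.<⇒≤ i<j))))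
                                                                         (ℤP.^-distribˡ-+-* r i (j ℕ.∸ i))))
                                       (pull-out (r ^ i) (r ^ (j ℕ.∸ i))))
                       (ℤD.∣m⇒∣-m (divides-difference c))
        where pull-out : ∀ (x y : ℤ) → - (x - x * y) ≡ x * (y - + 1)
              pull-out = solve-∀
      φM∣j-i : φM ∣ℕ j ℕ.∸ i
      φM∣j-i = order∣ o (j ℕ.∸ i) (congruent (prime^-cancel pr (suc α) (prime∤^ pr p∤r i) factored))

    discrete-log : ∀ r → HasOrder (+ M) r φM → ∀ y → ¬ (+ p ∣ y) → Σ ℕ λ s → y ≈ r ^ s [mod + M ]
    discrete-log r o y p∤y = collision (FP.pigeonhole (ℕP.n<1+n φM) slot)
      where
      candidate : Fin (suc φM) → ℤ
      candidate F.zero    = y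
      candidate (F.suc i) = r ^ toℕ i
      candidate-unit : ∀ i → ¬ (+ p ∣ candidate i)
      candidate-unit F.zero    = p∤y
      candidate-unit (F.suc i) = prime∤^ pr (order⇒prime∤ pr p∣M 0<φM o) (toℕ i)
      slot : Fin (suc φM) → Fin φM
      slot i = F.fromℕ< (code< (candidate i) (candidate-unit i))
      same-slot : ∀ i j → slot i ≡ slot j → candidate i ≈ candidate j [mod + M ]
      same-slot i j e = code-injective _ _ (candidate-unit i) (candidate-unit j)
                              (trans (sym (FP.toℕ-fromℕ< _)) (trans (cong toℕ e) (FP.toℕ-fromℕ< _)))
      collision : (∃ λ i → ∃ λ j → i F.< j × slot i ≡ slot j) → Σ ℕ λ s → y ≈ r ^ s [mod + M ]
      collision (F.zero  , F.suc j , _         , e) = toℕ j , same-slot F.zero (F.suc j) e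
      collision (F.suc i , F.suc j , s≤s i<j , e) = ⊥-elim (powers-distinct o (toℕ i) (toℕ j) i<j (FP.toℕ<n j) (same-slot (F.suc i) (F.suc j) e))

  does-⇔ : ∀ {A B : Set} (a? : Dec A) (b? : Dec B) → (A → B) → (B → A) → does a? ≡ does b?
  does-⇔ a? b? to from = does-≡ a? (map′ from to b?)

  indicator : Bool → ℕ
  indicator true  = 1
  indicator false = 0

  count : (ℕ → Bool) → ℕ → ℕ
  count f zero    = 0
  count f (suc n) = count f n ℕ.+ indicator (f (suc n))

  count-ext : ∀ f g n → (∀ k → f k ≡ g k) → count f n ≡ count g n
  count-ext f g zero    f≗g = refl
  count-ext f g (suc n) f≗g = cong₂ ℕ._+_ (count-ext f g n f≗g) (cong indicator (f≗g (suc n)))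

  φ-count : ∀ n → φ n ≡ count (λ k → does (coprime? k n)) n
  φ-count n = filter-count n
    where
    filter-count : ∀ m → length (filter (λ k → coprime? k n) (map suc (upTo m))) ≡ count (λ k → does (coprime? k n)) m
    filter-count zero = refl
    filter-count (suc m) = begin
      length (filter P? (map suc (upTo (suc m))))              ≡⟨ cong (λ l → length (filter P? (map suc l))) (ListP.upTo-∷ʳ m) ⟨
      length (filter P? (map suc (upTo m ++ [ m ])))           ≡⟨ cong (λ l → length (filter P? l)) (ListP.map-++ suc (upTo m) [ m ]) ⟩
      length (filter P? (map suc (upTo m) ++ [ suc m ]))       ≡⟨ cong length (ListP.filter-++ P? (map suc (upTo m)) [ suc m ]) ⟩
      length (filter P? (map suc (upTo m)) ++ filter P? [ suc m ]) ≡⟨ ListP.length-++ (filter P? (map suc (upTo m))) ⟩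
      length (filter P? (map suc (upTo m))) ℕ.+ length (filter P? [ suc m ]) ≡⟨ cong₂ ℕ._+_ (filter-count m) (singleton (suc m)) ⟩
      count (λ k → does (coprime? k n)) (suc m)                     ∎
      where
      open ≡-Reasoning
      P? = λ k → coprime? k n
      singleton : ∀ x → length (filter P? [ x ]) ≡ indicator (does (P? x))
      singleton x with does (P? x)
      ... | true  = refl
      ... | false = refl

  count-complement : ∀ a n → count (λ k → not (a k)) n ℕ.+ count a n ≡ n
  count-complement a zero = refl
  count-complement a (suc n) = begin
    (count (not ∘ a) n ℕ.+ indicator (not (a (suc n)))) ℕ.+ (count a n ℕ.+ indicator (a (suc n)))
      ≡⟨ interchange (count (not ∘ a) n) (count a n) (indicator (not (a (suc n)))) (indicator (a (suc n))) ⟩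
    (count (not ∘ a) n ℕ.+ count a n) ℕ.+ (indicator (not (a (suc n))) ℕ.+ indicator (a (suc n)))
      ≡⟨ cong₂ ℕ._+_ (count-complement a n) (one (a (suc n))) ⟩
    n ℕ.+ 1
      ≡⟨ ℕP.+-comm n 1 ⟩
    suc n ∎
    where
    open ≡-Reasoning
    interchange : ∀ x y u v → (x ℕ.+ u) ℕ.+ (y ℕ.+ v) ≡ (x ℕ.+ y) ℕ.+ (u ℕ.+ v)
    interchange = ℕSolver.solve-∀
    one : ∀ b → indicator (not b) ℕ.+ indicator b ≡ 1
    one true  = refl
    one false = refl

  count-inclusion-exclusion : ∀ a b n →
    count (λ k → not (a k) ∧ not (b k)) n ℕ.+ count a n ℕ.+ count b n ≡ n ℕ.+ count (λ k → a k ∧ b k) n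
  count-inclusion-exclusion a b zero = refl
  count-inclusion-exclusion a b (suc n) = begin
    (N ℕ.+ x) ℕ.+ (A ℕ.+ y) ℕ.+ (B ℕ.+ z)           ≡⟨ regroup N A B x y z ⟩
    (N ℕ.+ A ℕ.+ B) ℕ.+ (x ℕ.+ y ℕ.+ z)       ≡⟨ cong₂ ℕ._+_ (count-inclusion-exclusion a b n) (pointwise (a (suc n)) (b (suc n))) ⟩
    (n ℕ.+ AB) ℕ.+ (1 ℕ.+ w)                  ≡⟨ shift n AB w ⟩
    suc n ℕ.+ (AB ℕ.+ w)                      ∎
    where
    open ≡-Reasoning
    N = count (λ k → not (a k) ∧ not (b k)) n
    A = count a n
    B = count b n
    AB = count (λ k → a k ∧ b k) n
    x = indicator (not (a (suc n)) ∧ not (b (suc n)))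
    y = indicator (a (suc n))
    z = indicator (b (suc n))
    w = indicator (a (suc n) ∧ b (suc n))
    regroup : ∀ N A B x y z → (N ℕ.+ x) ℕ.+ (A ℕ.+ y) ℕ.+ (B ℕ.+ z) ≡ (N ℕ.+ A ℕ.+ B) ℕ.+ (x ℕ.+ y ℕ.+ z)
    regroup = ℕSolver.solve-∀
    shift : ∀ n c w → (n ℕ.+ c) ℕ.+ (1 ℕ.+ w) ≡ suc n ℕ.+ (c ℕ.+ w)
    shift = ℕSolver.solve-∀
    pointwise : ∀ u v → indicator (not u ∧ not v) ℕ.+ indicator u ℕ.+ indicator v ≡ 1 ℕ.+ indicator (u ∧ v)
    pointwise true  true  = refl
    pointwise true  false = refl
    pointwise false true  = refl
    pointwise false false = refl

  count-multiples : ∀ d c → .{{_ : ℕ.NonZero d}} → count (λ k → does (d ℕD.∣? k)) (c ℕ.* d) ≡ c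
  count-multiples d zero = refl
  count-multiples d@(suc d-1) (suc c) = begin
    count multiple? (d ℕ.+ c ℕ.* d)        ≡⟨ cong (count multiple?) (ℕP.+-comm d (c ℕ.* d)) ⟩
    count multiple? (c ℕ.* d ℕ.+ suc d-1)  ≡⟨ cong (count multiple?) (ℕP.+-suc (c ℕ.* d) d-1) ⟩
    count multiple? (c ℕ.* d ℕ.+ d-1) ℕ.+ indicator (multiple? (suc (c ℕ.* d ℕ.+ d-1)))
                                           ≡⟨ cong₂ ℕ._+_ (below-next-multiple d-1 (ℕP.n<1+n d-1)) (cong indicator next-multiple) ⟩
    c ℕ.+ 1                                ≡⟨ ℕP.+-comm c 1 ⟩
    suc c                                  ∎
    where
    open ≡-Reasoning
    multiple? : ℕ → Bool
    multiple? k = does (d ℕD.∣? k)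
    next-multiple : multiple? (suc (c ℕ.* d ℕ.+ d-1)) ≡ true
    next-multiple = dec-true (d ℕD.∣? _) (ℕD.divides (suc c) (trans (sym (ℕP.+-suc (c ℕ.* d) d-1)) (ℕP.+-comm (c ℕ.* d) d)))
    non-multiple : ∀ j → 0 ℕ.< j → j ℕ.< d → multiple? (c ℕ.* d ℕ.+ j) ≡ false
    non-multiple j 0<j j<d = dec-false (d ℕD.∣? _)
      (λ d∣ → ℕP.<⇒≱ j<d (ℕD.∣⇒≤ {{ℕ.>-nonZero 0<j}} (ℕD.∣m+n∣m⇒∣n d∣ (ℕD.n∣m*n c))))
    below-next-multiple : ∀ j → j ℕ.< d → count multiple? (c ℕ.* d ℕ.+ j) ≡ c
    below-next-multiple zero _ = trans (cong (count multiple?) (ℕP.+-identityʳ (c ℕ.* d))) (count-multiples d c)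
    below-next-multiple (suc j) j+1<d = begin
      count multiple? (c ℕ.* d ℕ.+ suc j)                                     ≡⟨ cong (count multiple?) (ℕP.+-suc (c ℕ.* d) j) ⟩
      count multiple? (c ℕ.* d ℕ.+ j) ℕ.+ indicator (multiple? (suc (c ℕ.* d ℕ.+ j)))
        ≡⟨ cong₂ ℕ._+_ (below-next-multiple j (ℕP.<-trans (ℕP.n<1+n j) j+1<d))
                       (cong indicator (trans (cong multiple? (sym (ℕP.+-suc (c ℕ.* d) j))) (non-multiple (suc j) (s≤s z≤n) j+1<d))) ⟩
      c ℕ.+ 0                                                                  ≡⟨ ℕP.+-identityʳ c ⟩
      c                                                                        ∎

  -- φ(p^(α+1)) = (p-1)·p^α: the non-units are the p^α multiples of p.
  φ-prime^ : ∀ {p} → Prime p → ∀ α → φ (p ℕ.^ suc α) ≡ (p ℕ.∸ 1) ℕ.* p ℕ.^ α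
  φ-prime^ {zero} pr α = ⊥-elim (ℕP.<⇒≱ (prime>1 pr) z≤n)
  φ-prime^ {suc p₁} pr α = ℕP.+-cancelʳ-≡ A (φ N) (p₁ ℕ.* A) (begin
    φ N ℕ.+ A                                                  ≡⟨ cong₂ ℕ._+_ (trans (φ-count N) (count-ext _ _ N unit⇔)) (sym multiples) ⟩
    count (λ k → not (multiple? k)) N ℕ.+ count multiple? N    ≡⟨ count-complement multiple? N ⟩
    A ℕ.+ p₁ ℕ.* A                                             ≡⟨ ℕP.+-comm A (p₁ ℕ.* A) ⟩
    p₁ ℕ.* A ℕ.+ A                                             ∎)
    where
    open ≡-Reasoning
    p = suc p₁
    A = p ℕ.^ α
    N = p ℕ.* A
    multiple? : ℕ → Bool
    multiple? k = does (p ℕD.∣? k)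
    unit⇔ : ∀ k → does (coprime? k N) ≡ not (multiple? k)
    unit⇔ k = does-⇔ (coprime? k N) (¬? (p ℕD.∣? k))
      (λ k⊥N p∣k → prime≢1 pr (k⊥N (p∣k , ℕD.divides A (ℕP.*-comm p A))))
      (λ p∤k → NC.sym (prime^-coprime pr p∤k (suc α)))
    multiples : count multiple? N ≡ A
    multiples = trans (cong (count multiple?) (ℕP.*-comm p A)) (count-multiples p A)

  -- φ(p^(α+1)·q^(β+1)) = φ(p^(α+1))·φ(q^(β+1)) for distinct primes p, q, by
  -- inclusion–exclusion over the multiples of p, of q and of pq.
  φ-prime^-product : ∀ {p q} → Prime p → Prime q → p ≢ q → ∀ α β →
    φ (p ℕ.^ suc α ℕ.* q ℕ.^ suc β) ≡ ((p ℕ.∸ 1) ℕ.* p ℕ.^ α) ℕ.* ((q ℕ.∸ 1) ℕ.* q ℕ.^ β)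
  φ-prime^-product {zero} pr qr p≢q α β = ⊥-elim (ℕP.<⇒≱ (prime>1 pr) z≤n)
  φ-prime^-product {suc p₁} {zero} pr qr p≢q α β = ⊥-elim (ℕP.<⇒≱ (prime>1 qr) z≤n)
  φ-prime^-product {suc p₁} {suc q₁} pr qr p≢q α β = ℕP.+-cancelʳ-≡ (A ℕ.* Q ℕ.+ P ℕ.* B) (φ N) _ (begin
    φ N ℕ.+ (A ℕ.* Q ℕ.+ P ℕ.* B)
      ≡⟨ sym (ℕP.+-assoc (φ N) _ _) ⟩
    φ N ℕ.+ A ℕ.* Q ℕ.+ P ℕ.* B
      ≡⟨ cong₂ (λ x y → x ℕ.+ y ℕ.+ P ℕ.* B) (trans (φ-count N) (count-ext _ _ N unit⇔)) (sym p-multiples) ⟩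
    count neither N ℕ.+ count p? N ℕ.+ P ℕ.* B
      ≡⟨ cong (count neither N ℕ.+ count p? N ℕ.+_) (sym q-multiples) ⟩
    count neither N ℕ.+ count p? N ℕ.+ count q? N
      ≡⟨ count-inclusion-exclusion p? q? N ⟩
    N ℕ.+ count (λ k → p? k ∧ q? k) N
      ≡⟨ cong (N ℕ.+_) pq-multiples ⟩
    N ℕ.+ A ℕ.* B
      ≡⟨ expand p₁ q₁ A B ⟩
    (p₁ ℕ.* A) ℕ.* (q₁ ℕ.* B) ℕ.+ (A ℕ.* Q ℕ.+ P ℕ.* B) ∎)
    where
    open ≡-Reasoning
    p = suc p₁
    q = suc q₁
    A = p ℕ.^ α
    B = q ℕ.^ β
    P = p ℕ.* A
    Q = q ℕ.* B
    N = P ℕ.* Q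
    p? q? neither : ℕ → Bool
    p? k = does (p ℕD.∣? k)
    q? k = does (q ℕD.∣? k)
    neither k = not (p? k) ∧ not (q? k)
    expand : ∀ p₁ q₁ A B → suc p₁ ℕ.* A ℕ.* (suc q₁ ℕ.* B) ℕ.+ A ℕ.* B ≡
             (p₁ ℕ.* A) ℕ.* (q₁ ℕ.* B) ℕ.+ (A ℕ.* (suc q₁ ℕ.* B) ℕ.+ suc p₁ ℕ.* A ℕ.* B)
    expand = ℕSolver.solve-∀
    p∣N : p ∣ℕ N
    p∣N = ℕD.∣-trans (ℕD.m∣m*n A) (ℕD.m∣m*n Q)
    q∣N : q ∣ℕ N
    q∣N = ℕD.∣-trans (ℕD.m∣m*n B) (ℕD.n∣m*n P)
    unit⇔ : ∀ k → does (coprime? k N) ≡ neither k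
    unit⇔ k = does-⇔ (coprime? k N) (¬? (p ℕD.∣? k) ×-dec ¬? (q ℕD.∣? k))
      (λ k⊥N → (λ p∣k → prime≢1 pr (k⊥N (p∣k , p∣N))) , (λ q∣k → prime≢1 qr (k⊥N (q∣k , q∣N))))
      (λ (p∤k , q∤k) → NC.sym (coprime-*ˡ (prime^-coprime pr p∤k (suc α)) (prime^-coprime qr q∤k (suc β))))
    both⇔ : ∀ k → p? k ∧ q? k ≡ does ((p ℕ.* q) ℕD.∣? k)
    both⇔ k = does-⇔ ((p ℕD.∣? k) ×-dec (q ℕD.∣? k)) ((p ℕ.* q) ℕD.∣? k)
      (λ (p∣k , q∣k) → coprime-∣* (distinct-primes-coprime pr qr p≢q) p∣k q∣k)
      (λ pq∣k → ℕD.∣-trans (ℕD.m∣m*n q) pq∣k , ℕD.∣-trans (ℕD.n∣m*n p) pq∣k)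
    p-multiples : count p? N ≡ A ℕ.* Q
    p-multiples = trans (cong (count p?) (rotate p A Q)) (count-multiples p (A ℕ.* Q))
      where rotate : ∀ p A Q → p ℕ.* A ℕ.* Q ≡ A ℕ.* Q ℕ.* p
            rotate = ℕSolver.solve-∀
    q-multiples : count q? N ≡ P ℕ.* B
    q-multiples = trans (cong (count q?) (rotate P q B)) (count-multiples q (P ℕ.* B))
      where rotate : ∀ P q B → P ℕ.* (q ℕ.* B) ≡ P ℕ.* B ℕ.* q
            rotate = ℕSolver.solve-∀
    pq-multiples : count (λ k → p? k ∧ q? k) N ≡ A ℕ.* B
    pq-multiples = trans (count-ext _ _ N both⇔) (trans (cong (count (λ k → does ((p ℕ.* q) ℕD.∣? k))) (rotate p q A B))
                                                        (count-multiples (p ℕ.* q) (A ℕ.* B)))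
      where rotate : ∀ p q A B → p ℕ.* A ℕ.* (q ℕ.* B) ≡ A ℕ.* B ℕ.* (p ℕ.* q)
            rotate = ℕSolver.solve-∀

  Conclusion : ℕ → ℕ → Set
  Conclusion n k =
      ( Σ ℤ λ g →
          BiquadraticResidue⋆ n g
        × ((b : ℤ) → BiquadraticResidue⋆ n b → Σ ℕ λ i → b ≡⋆ (g ^ i) [mod n ])
        × ((i : ℕ) → BiquadraticResidue⋆ n (g ^ i))
        × (g ^ (2 ℕ.* k ℕ.+ 1)) ≡⋆ (+ 1) [mod n ]
        × ((i : ℕ) → i ℕ.≥ 1 → i ℕ.< 2 ℕ.* k ℕ.+ 1 → ¬ ((g ^ i) ≡⋆ (+ 1) [mod n ])) )
      × ((b : ℤ) → BiquadraticResidue⋆ n b →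
           ((b ^ (k ℕ.+ 1)) ^ 2) ≡⋆ b [mod n ]
         × BiquadraticResidue⋆ n (b ^ (k ℕ.+ 1)))

  infix 4 _≈±1[mod_]
  _≈±1[mod_] : ℤ → ℤ → Set
  x ≈±1[mod N ] = x ≈ + 1 [mod N ] ⊎ x ≈ - + 1 [mod N ]

  ±1-* : ∀ {N x y} → x ≈±1[mod N ] → y ≈±1[mod N ] → x * y ≈±1[mod N ]
  ±1-* (inj₁ x≈1)  (inj₁ y≈1)  = inj₁ (≈-* x≈1 y≈1)
  ±1-* (inj₁ x≈1)  (inj₂ y≈-1) = inj₂ (≈-* x≈1 y≈-1)
  ±1-* (inj₂ x≈-1) (inj₁ y≈1)  = inj₂ (≈-* x≈-1 y≈1)
  ±1-* (inj₂ x≈-1) (inj₂ y≈-1) = inj₁ (≈-* x≈-1 y≈-1)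

  ±1-^ : ∀ {N x} k → x ≈±1[mod N ] → x ^ k ≈±1[mod N ]
  ±1-^ zero    _   = inj₁ (≈-refl _)
  ±1-^ (suc k) x±1 = ±1-* x±1 (±1-^ k x±1)

  ±1-resp : ∀ {N x y} → x ≈ y [mod N ] → y ≈±1[mod N ] → x ≈±1[mod N ]
  ±1-resp x≈y (inj₁ y≈1)  = inj₁ (≈-trans x≈y y≈1)
  ±1-resp x≈y (inj₂ y≈-1) = inj₂ (≈-trans x≈y y≈-1)

  ±1-square : ∀ {N x} → x ≈±1[mod N ] → x * x ≈ + 1 [mod N ]
  ±1-square (inj₁ x≈1)  = ≈-* x≈1 x≈1
  ±1-square (inj₂ x≈-1) = ≈-* x≈-1 x≈-1

  ≡⋆-intro : ∀ {n} a b → a ≈ b [mod + n ] ⊎ a ≈ - b [mod + n ] → a ≡⋆ b [mod n ]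
  ≡⋆-intro a b (inj₁ (congruent d)) = inj₁ (ℤD.∣⇒∣ᵤ d)
  ≡⋆-intro {n} a b (inj₂ (congruent d)) = inj₂ (ℤD.∣⇒∣ᵤ (subst (+ n ∣_) (minus-minus a b) d))
    where minus-minus : ∀ (a b : ℤ) → a - - b ≡ a + b
          minus-minus = solve-∀

  ≡⋆-elim : ∀ {n} a b → a ≡⋆ b [mod n ] → a ≈ b [mod + n ] ⊎ a ≈ - b [mod + n ]
  ≡⋆-elim a b (inj₁ d) = inj₁ (congruent (ℤD.∣ᵤ⇒∣ d))
  ≡⋆-elim {n} a b (inj₂ d) = inj₂ (congruent (subst (+ n ∣_) (sym (minus-minus a b)) (ℤD.∣ᵤ⇒∣ d)))
    where minus-minus : ∀ (a b : ℤ) → a - - b ≡ a + b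
          minus-minus = solve-∀

  coprimeTo-1 : ∀ n → CoprimeTo n (+ 1)
  coprimeTo-1 n (i∣1 , _) = ℕD.∣1⇒≡1 i∣1

  coprimeTo-* : ∀ {n} a b → CoprimeTo n a → CoprimeTo n b → CoprimeTo n (a * b)
  coprimeTo-* {n} a b a⊥n b⊥n = subst (λ z → Coprime z n) (sym (ℤP.abs-* a b)) (coprime-*ˡ a⊥n b⊥n)

  coprimeTo-^ : ∀ {n} a k → CoprimeTo n a → CoprimeTo n (a ^ k)
  coprimeTo-^ {n} a zero    _   = coprimeTo-1 n
  coprimeTo-^     a (suc k) a⊥n = coprimeTo-* a (a ^ k) a⊥n (coprimeTo-^ a k a⊥n)

  ≡⋆⇒sign : ∀ {n} a c → a ≡⋆ c [mod n ] → Σ ℤ λ e → e ≈±1[mod + n ] × a ≈ e * c [mod + n ]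
  ≡⋆⇒sign a c a≡⋆c with ≡⋆-elim a c a≡⋆c
  ... | inj₁ a≈c  = + 1 , inj₁ (≈-refl _) , ≈-trans a≈c (≈-reflexive (sym (ℤP.*-identityˡ c)))
  ... | inj₂ a≈-c = - + 1 , inj₂ (≈-refl _) , ≈-trans a≈-c (≈-reflexive (sym (ℤP.-1*i≡-i c)))

  sign⇒≡⋆ : ∀ {n e} a c → e ≈±1[mod + n ] → a ≈ e * c [mod + n ] → a ≡⋆ c [mod n ]
  sign⇒≡⋆ a c (inj₁ e≈1)  a≈ec = ≡⋆-intro a c (inj₁ (≈-trans a≈ec (≈-trans (≈-*ʳ c e≈1) (≈-reflexive (ℤP.*-identityˡ c)))))
  sign⇒≡⋆ a c (inj₂ e≈-1) a≈ec = ≡⋆-intro a c (inj₂ (≈-trans a≈ec (≈-trans (≈-*ʳ c e≈-1) (≈-reflexive (ℤP.-1*i≡-i c)))))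

  record FourthPowerStructure (n m : ℕ) : Set where
    field
      base                  : ℤ
      base-unit             : CoprimeTo n base
      fourth-power-log      : ∀ y → CoprimeTo n y → Σ ℕ λ s → y ^ 4 ≈ (base ^ 4) ^ s [mod + n ]
      fourth-power-exponent : ∀ y → CoprimeTo n y → y ^ (4 ℕ.* m) ≈±1[mod + n ]
      generator-order       : ∀ i → (base ^ 4) ^ i ≈±1[mod + n ] → m ∣ℕ i

  module FourthPowerConsequences {n k} (S : FourthPowerStructure n (2 ℕ.* k ℕ.+ 1)) where
    open FourthPowerStructure S

    m = 2 ℕ.* k ℕ.+ 1
    N = + n
    g = base ^ 4

    residue-of : ∀ y → CoprimeTo n y → BiquadraticResidue⋆ n (y ^ 4)
    residue-of y y⊥n = coprimeTo-^ y 4 y⊥n , y , y⊥n , ≡⋆-intro (y ^ 4) (y ^ 4) (inj₁ (≈-refl _))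

    -- The powers of g are biquadratic residues, and every biquadratic residue
    -- b ≡ ±y⁴ is one of them since y⁴ is a power of g.
    powers-residues : ∀ i → BiquadraticResidue⋆ n (g ^ i)
    powers-residues i = subst (BiquadraticResidue⋆ n) (sym (^-*-comm base 4 i)) (residue-of (base ^ i) (coprimeTo-^ base i base-unit))

    generates : ∀ b → BiquadraticResidue⋆ n b → Σ ℕ λ i → b ≡⋆ (g ^ i) [mod n ]
    generates b (_ , y , y⊥n , b≡⋆y⁴) =
      let (e , e±1 , b≈ey⁴) = ≡⋆⇒sign b (y ^ 4) b≡⋆y⁴
          (s , y⁴≈g^s)      = fourth-power-log y y⊥n
      in s , sign⇒≡⋆ b (g ^ s) e±1 (≈-trans b≈ey⁴ (≈-*ˡ e y⁴≈g^s))

    g^m≡⋆1 : (g ^ m) ≡⋆ (+ 1) [mod n ]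
    g^m≡⋆1 = ≡⋆-intro (g ^ m) (+ 1) (±1-resp (≈-reflexive (sym (^-* base 4 m))) (fourth-power-exponent base base-unit))

    g^i≢⋆1 : ∀ i → i ℕ.≥ 1 → i ℕ.< m → ¬ ((g ^ i) ≡⋆ (+ 1) [mod n ])
    g^i≢⋆1 i i≥1 i<m g^i≡⋆1 = ℕP.<⇒≱ i<m (ℕD.∣⇒≤ {{ℕ.>-nonZero i≥1}} (generator-order i (≡⋆-elim (g ^ i) (+ 1) g^i≡⋆1)))

    -- For b ≡ e·y⁴ with e ≡ ±1:  b^j ≡ e^j·(y^j)⁴, so b^m ≡ ±1; hence
    -- (b^(k+1))² = b^m·b ≡ ±b, and b^(k+1) ≡ ±(y^(k+1))⁴ is a biquadratic residue.
    square-root : ∀ b → BiquadraticResidue⋆ n b →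
                  ((b ^ (k ℕ.+ 1)) ^ 2) ≡⋆ b [mod n ] × BiquadraticResidue⋆ n (b ^ (k ℕ.+ 1))
    square-root b (b⊥n , y , y⊥n , b≡⋆y⁴) = square≡⋆b , root-residue
      where
      e = proj₁ (≡⋆⇒sign b (y ^ 4) b≡⋆y⁴)
      e±1 : e ≈±1[mod N ]
      e±1 = proj₁ (proj₂ (≡⋆⇒sign b (y ^ 4) b≡⋆y⁴))
      b≈ey⁴ : b ≈ e * y ^ 4 [mod N ]
      b≈ey⁴ = proj₂ (proj₂ (≡⋆⇒sign b (y ^ 4) b≡⋆y⁴))
      b^j≈ : ∀ j → b ^ j ≈ e ^ j * (y ^ j) ^ 4 [mod N ]
      b^j≈ j = ≈-trans (≈-^ j b≈ey⁴) (≈-reflexive (trans (^-distrib-* e (y ^ 4) j) (cong (e ^ j *_) (^-*-comm y 4 j))))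
      b^m±1 : b ^ m ≈±1[mod N ]
      b^m±1 = ±1-resp (≈-trans (b^j≈ m) (≈-reflexive (cong (e ^ m *_) (trans (^-*-comm y m 4) (sym (^-* y 4 m))))))
                      (±1-* (±1-^ m e±1) (fourth-power-exponent y y⊥n))
      square≡ : (b ^ (k ℕ.+ 1)) ^ 2 ≡ b ^ m * b
      square≡ = begin
        (b ^ (k ℕ.+ 1)) ^ 2        ≡⟨ ^-* b (k ℕ.+ 1) 2 ⟨
        b ^ ((k ℕ.+ 1) ℕ.* 2)      ≡⟨ cong (b ^_) (double-plus-one k) ⟩
        b ^ (m ℕ.+ 1)              ≡⟨ ℤP.^-distribˡ-+-* b m 1 ⟩
        b ^ m * b ^ 1              ≡⟨ cong (b ^ m *_) (ℤP.^-identityʳ b) ⟩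
        b ^ m * b                  ∎
        where
        open ≡-Reasoning
        double-plus-one : ∀ k → (k ℕ.+ 1) ℕ.* 2 ≡ 2 ℕ.* k ℕ.+ 1 ℕ.+ 1
        double-plus-one = ℕSolver.solve-∀
      square≡⋆b : ((b ^ (k ℕ.+ 1)) ^ 2) ≡⋆ b [mod n ]
      square≡⋆b = sign⇒≡⋆ _ b b^m±1 (≈-reflexive square≡)
      root-residue : BiquadraticResidue⋆ n (b ^ (k ℕ.+ 1))
      root-residue = coprimeTo-^ b (k ℕ.+ 1) b⊥n , y ^ (k ℕ.+ 1) , coprimeTo-^ y (k ℕ.+ 1) y⊥n ,
                     sign⇒≡⋆ (b ^ (k ℕ.+ 1)) ((y ^ (k ℕ.+ 1)) ^ 4) (±1-^ (k ℕ.+ 1) e±1) (b^j≈ (k ℕ.+ 1))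

  structure⇒conclusion : ∀ n k → FourthPowerStructure n (2 ℕ.* k ℕ.+ 1) → Conclusion n k
  structure⇒conclusion n k S =
    (g , residue-of base base-unit , generates , powers-residues , g^m≡⋆1 , g^i≢⋆1) , square-root
    where
    open FourthPowerStructure S using (base; base-unit)
    open FourthPowerConsequences {n} {k} S

  coprimeTo⇒prime∤ : ∀ {n p y} → Prime p → p ∣ℕ n → CoprimeTo n y → ¬ (+ p ∣ y)
  coprimeTo⇒prime∤ pr p∣n y⊥n p∣y = prime≢1 pr (y⊥n (ℤD.∣⇒∣ᵤ p∣y , p∣n))

  prime∤⇒coprimeTo : ∀ {p y} → Prime p → ¬ (+ p ∣ y) → ∀ k → CoprimeTo (p ℕ.^ k) y
  prime∤⇒coprimeTo pr p∤y k = NC.sym (prime^-coprime pr (λ p∣y → p∤y (ℤD.∣ᵤ⇒∣ p∣y)) k)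

  -- Case n = p^(α+1) with φ(n) = 8m: a primitive root r serves as base.  Every
  -- unit is a power of r; the square of y^(4m) is y^φ(n) ≡ 1, so y^(4m) ≡ ±1
  -- since p is odd; and (r⁴)^i ≡ ±1 gives r^(8i) ≡ 1, so 8m ∣ 8i.
  prime-power-structure : ∀ {p} → Prime p → p ≢ 2 → ∀ α m → φ (p ℕ.^ suc α) ≡ 8 ℕ.* m →
                          FourthPowerStructure (p ℕ.^ suc α) m
  prime-power-structure {p} pr p≢2 α m φ≡8m = record
    { base                  = r
    ; base-unit             = prime∤⇒coprimeTo pr p∤r (suc α)
    ; fourth-power-log       = fourth-power-log
    ; fourth-power-exponent = fourth-power-exponent
    ; generator-order       = generator-order
    }
    where
    open OddPrimePower pr p≢2 using (primitive-root)
    open DiscreteLogarithm pr α using (M; φM; discrete-log; p∣M; 0<φM)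
    r = proj₁ (primitive-root α)
    order-r : HasOrder (+ M) r φM
    order-r = proj₂ (primitive-root α)
    φM≡8m : φM ≡ 8 ℕ.* m
    φM≡8m = trans (sym (φ-prime^ pr α)) φ≡8m
    p∤r : ¬ (+ p ∣ r)
    p∤r = order⇒prime∤ pr p∣M 0<φM order-r
    p∣M′ : p ∣ℕ M
    p∣M′ = ℕD.divides (p ℕ.^ α) (ℕP.*-comm p (p ℕ.^ α))
    log : ∀ y → CoprimeTo M y → Σ ℕ λ s → y ≈ r ^ s [mod + M ]
    log y y⊥M = discrete-log r order-r y (coprimeTo⇒prime∤ pr p∣M′ y⊥M)
    fourth-power-log : ∀ y → CoprimeTo M y → Σ ℕ λ s → y ^ 4 ≈ (r ^ 4) ^ s [mod + M ]
    fourth-power-log y y⊥M = let (s , y≈r^s) = log y y⊥M in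
      s , ≈-trans (≈-^ 4 y≈r^s) (≈-reflexive (^-*-comm r s 4))
    fourth-power-exponent : ∀ y → CoprimeTo M y → y ^ (4 ℕ.* m) ≈±1[mod + M ]
    fourth-power-exponent y y⊥M = let (s , y≈r^s) = log y y⊥M in
      sqrt-of-one pr p≢2 (suc α) (y ^ (4 ℕ.* m)) (begin
        y ^ (4 ℕ.* m) * y ^ (4 ℕ.* m)  ≡⟨ ^-double y (4 ℕ.* m) ⟩
        y ^ (2 ℕ.* (4 ℕ.* m))          ≡⟨ cong (y ^_) (trans (sym (ℕP.*-assoc 2 4 m)) (sym φM≡8m)) ⟩
        y ^ φM                         ≈⟨ power-of-order s order-r y≈r^s ⟩
        + 1                            ∎)
      where open ≈-Reasoning (+ M)
    generator-order : ∀ i → (r ^ 4) ^ i ≈±1[mod + M ] → m ∣ℕ i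
    generator-order i r⁴ⁱ±1 = ℕD.*-cancelˡ-∣ 8 (subst (_∣ℕ 8 ℕ.* i) φM≡8m (order∣ order-r (8 ℕ.* i) (begin
      r ^ (8 ℕ.* i)                       ≡⟨ cong (r ^_) (ℕP.*-assoc 2 4 i) ⟩
      r ^ (2 ℕ.* (4 ℕ.* i))               ≡⟨ ^-double r (4 ℕ.* i) ⟨
      r ^ (4 ℕ.* i) * r ^ (4 ℕ.* i)       ≡⟨ cong₂ _*_ (^-* r 4 i) (^-* r 4 i) ⟩
      (r ^ 4) ^ i * (r ^ 4) ^ i           ≈⟨ ±1-square r⁴ⁱ±1 ⟩
      + 1                                 ∎)))
      where open ≈-Reasoning (+ M)

  ≈-coprime-moduli : ∀ {P Q x z} → Coprime P Q → x ≈ z [mod + P ] → x ≈ z [mod + Q ] → x ≈ z [mod + (P ℕ.* Q) ]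
  ≈-coprime-moduli P⊥Q (congruent P∣) (congruent Q∣) = congruent (ℤD.∣ᵤ⇒∣ (coprime-∣* P⊥Q (ℤD.∣⇒∣ᵤ P∣) (ℤD.∣⇒∣ᵤ Q∣)))

  crt-idempotent : ∀ {P Q} → Coprime P Q → Σ ℤ λ e → e ≈ + 0 [mod + P ] × e ≈ + 1 [mod + Q ]
  crt-idempotent {P} {Q} P⊥Q with NC.coprime-Bézout P⊥Q
  ... | Bézout.+- x y 1+yQ≡xP = + (x ℕ.* P) , ≈0 , congruent (ℤD.divides (+ y) (begin
    + (x ℕ.* P) - + 1        ≡⟨ cong (λ t → + t - + 1) 1+yQ≡xP ⟨
    + (1 ℕ.+ y ℕ.* Q) - + 1  ≡⟨ cong (_- + 1) (trans (ℤP.pos-+ 1 (y ℕ.* Q)) (cong (λ t → + 1 + t) (ℤP.pos-* y Q))) ⟩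
    + 1 + + y * + Q - + 1    ≡⟨ cancel (+ y * + Q) ⟩
    + y * + Q                ∎))
    where
    open ≡-Reasoning
    cancel : ∀ (a : ℤ) → + 1 + a - + 1 ≡ a
    cancel = solve-∀
    ≈0 : + (x ℕ.* P) ≈ + 0 [mod + P ]
    ≈0 = congruent (ℤD.divides (+ x) (trans (ℤP.+-identityʳ _) (ℤP.pos-* x P)))
  ... | Bézout.-+ x y 1+xP≡yQ = - + (x ℕ.* P) , ≈0 , congruent (ℤD.divides (- + y) (begin
    - + (x ℕ.* P) - + 1        ≡⟨ negate (+ (x ℕ.* P)) ⟩
    - (+ 1 + + (x ℕ.* P))      ≡⟨ cong (λ t → - t) (trans (sym (ℤP.pos-+ 1 (x ℕ.* P))) (cong +_ 1+xP≡yQ)) ⟩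
    - + (y ℕ.* Q)              ≡⟨ cong -_ (ℤP.pos-* y Q) ⟩
    - (+ y * + Q)              ≡⟨ ℤP.neg-distribˡ-* (+ y) (+ Q) ⟩
    - + y * + Q                ∎))
    where
    open ≡-Reasoning
    negate : ∀ (a : ℤ) → - a - + 1 ≡ - (+ 1 + a)
    negate = solve-∀
    ≈0 : - + (x ℕ.* P) ≈ + 0 [mod + P ]
    ≈0 = congruent (ℤD.divides (- + x) (trans (ℤP.+-identityʳ _) (trans (cong -_ (ℤP.pos-* x P)) (ℤP.neg-distribˡ-* (+ x) (+ P)))))

  crt : ∀ {P Q} → Coprime P Q → ∀ a b → Σ ℤ λ y → y ≈ a [mod + P ] × y ≈ b [mod + Q ]
  crt {P} {Q} P⊥Q a b = a + (b - a) * e , ≈a , ≈b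
    where
    e = proj₁ (crt-idempotent P⊥Q)
    ≈a : a + (b - a) * e ≈ a [mod + P ]
    ≈a = ≈-trans (≈-+ (≈-refl a) (≈-*ˡ (b - a) (proj₁ (proj₂ (crt-idempotent P⊥Q))))) (≈-reflexive (vanish a (b - a)))
      where vanish : ∀ (a c : ℤ) → a + c * + 0 ≡ a
            vanish = solve-∀
    ≈b : a + (b - a) * e ≈ b [mod + Q ]
    ≈b = ≈-trans (≈-+ (≈-refl a) (≈-*ˡ (b - a) (proj₂ (proj₂ (crt-idempotent P⊥Q))))) (≈-reflexive (telescope a b))
      where telescope : ∀ (a b : ℤ) → a + (b - a) * + 1 ≡ b
            telescope = solve-∀

  -- a ≡ b (mod c) for natural numbers, witnessed without subtraction.
  record _≡_[modℕ_] (a b c : ℕ) : Set where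
    constructor shifts
    field
      u v      : ℕ
      equation : a ℕ.+ c ℕ.* u ≡ b ℕ.+ c ℕ.* v

  -- Chinese remainder theorem for exponents: given a Bézout identity
  -- 1 + y·c₂ = x·c₁ (c₂ > 0), the number  i = s + x·c₁·(t + (c₂-1)·s)
  -- is ≡ s (mod c₁) and ≡ t (mod c₂).
  crt-from-bézout : ∀ c₁ c₂′ x y → 1 ℕ.+ y ℕ.* suc c₂′ ≡ x ℕ.* c₁ → ∀ s t →
                    Σ ℕ λ i → i ≡ s [modℕ c₁ ] × i ≡ t [modℕ suc c₂′ ]
  crt-from-bézout c₁ c₂′ x y bézout s t =
    s ℕ.+ x ℕ.* c₁ ℕ.* W , shifts 0 (x ℕ.* W) (mod-c₁ s x c₁ W) , shifts 0 (s ℕ.+ y ℕ.* W) mod-c₂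
    where
    W = t ℕ.+ c₂′ ℕ.* s
    mod-c₁ : ∀ s x c₁ W → s ℕ.+ x ℕ.* c₁ ℕ.* W ℕ.+ c₁ ℕ.* 0 ≡ s ℕ.+ c₁ ℕ.* (x ℕ.* W)
    mod-c₁ = ℕSolver.solve-∀
    expand : ∀ s t c₂′ y → s ℕ.+ (1 ℕ.+ y ℕ.* suc c₂′) ℕ.* (t ℕ.+ c₂′ ℕ.* s) ℕ.+ suc c₂′ ℕ.* 0 ≡
             t ℕ.+ suc c₂′ ℕ.* (s ℕ.+ y ℕ.* (t ℕ.+ c₂′ ℕ.* s))
    expand = ℕSolver.solve-∀
    mod-c₂ : s ℕ.+ x ℕ.* c₁ ℕ.* W ℕ.+ suc c₂′ ℕ.* 0 ≡ t ℕ.+ suc c₂′ ℕ.* (s ℕ.+ y ℕ.* W)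
    mod-c₂ = trans (cong (λ z → s ℕ.+ z ℕ.* W ℕ.+ suc c₂′ ℕ.* 0) (sym bézout)) (expand s t c₂′ y)

  exponent-crt : ∀ {c₁ c₂} → Coprime c₁ c₂ → 0 ℕ.< c₁ → 0 ℕ.< c₂ → ∀ s t →
                 Σ ℕ λ i → i ≡ s [modℕ c₁ ] × i ≡ t [modℕ c₂ ]
  exponent-crt {c₁} {suc c₂′} c₁⊥c₂ _ _ s t with NC.coprime-Bézout c₁⊥c₂
  ... | Bézout.+- x y 1+yc₂≡xc₁ = crt-from-bézout c₁ c₂′ x y 1+yc₂≡xc₁ s t
  exponent-crt {suc c₁′} {c₂} c₁⊥c₂ _ _ s t | Bézout.-+ x y 1+xc₁≡yc₂ =
    let (i , i≡t , i≡s) = crt-from-bézout c₂ c₁′ y x 1+xc₁≡yc₂ t s in i , i≡s , i≡t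

  fourth-power-exponent-mod : ∀ {M r c a b} → HasOrder M r (c ℕ.* 2) → a ≡ b [modℕ c ] →
                              r ^ (4 ℕ.* a) ≈ r ^ (4 ℕ.* b) [mod M ]
  fourth-power-exponent-mod {M} {r} {c} {a} {b} o (shifts u v a+cu≡b+cv) = begin
    r ^ (4 ℕ.* a)                  ≈⟨ shift a u ⟩
    r ^ (4 ℕ.* (a ℕ.+ c ℕ.* u))    ≡⟨ cong (λ e → r ^ (4 ℕ.* e)) a+cu≡b+cv ⟩
    r ^ (4 ℕ.* (b ℕ.+ c ℕ.* v))    ≈⟨ shift b v ⟨
    r ^ (4 ℕ.* b)                  ∎
    where
    open ≈-Reasoning M
    shift : ∀ a u → r ^ (4 ℕ.* a) ≈ r ^ (4 ℕ.* (a ℕ.+ c ℕ.* u)) [mod M ]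
    shift a u = begin
      r ^ (4 ℕ.* a)                           ≡⟨ ℤP.*-identityʳ _ ⟨
      r ^ (4 ℕ.* a) * + 1                     ≈⟨ ≈-*ˡ (r ^ (4 ℕ.* a)) period ⟨
      r ^ (4 ℕ.* a) * r ^ (4 ℕ.* (c ℕ.* u))   ≡⟨ ℤP.^-distribˡ-+-* r (4 ℕ.* a) _ ⟨
      r ^ (4 ℕ.* a ℕ.+ 4 ℕ.* (c ℕ.* u))       ≡⟨ cong (r ^_) (ℕP.*-distribˡ-+ 4 a (c ℕ.* u)) ⟨
      r ^ (4 ℕ.* (a ℕ.+ c ℕ.* u))             ∎
      where
      four-cu : ∀ c u → 4 ℕ.* (c ℕ.* u) ≡ 2 ℕ.* u ℕ.* (c ℕ.* 2)
      four-cu = ℕSolver.solve-∀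
      period : r ^ (4 ℕ.* (c ℕ.* u)) ≈ + 1 [mod M ]
      period = ≈1-multiple _ (pow-order≈1 o) (ℕD.divides (2 ℕ.* u) (four-cu c u))

  record Halves (a b m : ℕ) : Set where
    field
      c₁ c₂   : ℕ
      a≡      : a ≡ c₁ ℕ.* 2
      b≡      : b ≡ c₂ ℕ.* 2
      c₁⊥c₂   : Coprime c₁ c₂
      c₁c₂≡2m : c₁ ℕ.* c₂ ≡ 2 ℕ.* m

  halves : ∀ a b m → gcd a b ≡ 2 → a ℕ.* b ≡ 8 ℕ.* m → Halves a b m
  halves a b m gcd≡2 ab≡8m with subst (_∣ℕ a) gcd≡2 (gcd[m,n]∣m a b) | subst (_∣ℕ b) gcd≡2 (gcd[m,n]∣n a b)
  ... | ℕD.divides c₁ a≡ | ℕD.divides c₂ b≡ = record { a≡ = a≡ ; b≡ = b≡ ; c₁⊥c₂ = c₁⊥c₂ ; c₁c₂≡2m = c₁c₂≡2m }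
    where
    c₁⊥c₂ : Coprime c₁ c₂
    c₁⊥c₂ = NC.gcd≡1⇒coprime (ℕP.*-cancelˡ-≡ (gcd c₁ c₂) 1 2 (begin
      2 ℕ.* gcd c₁ c₂            ≡⟨ c*gcd[m,n]≡gcd[cm,cn] 2 c₁ c₂ ⟩
      gcd (2 ℕ.* c₁) (2 ℕ.* c₂)  ≡⟨ cong₂ gcd (trans (ℕP.*-comm 2 c₁) (sym a≡)) (trans (ℕP.*-comm 2 c₂) (sym b≡)) ⟩
      gcd a b                    ≡⟨ gcd≡2 ⟩
      2 ℕ.* 1                    ∎))
      where open ≡-Reasoning
    c₁c₂≡2m : c₁ ℕ.* c₂ ≡ 2 ℕ.* m
    c₁c₂≡2m = ℕP.*-cancelˡ-≡ (c₁ ℕ.* c₂) (2 ℕ.* m) 4 (begin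
      4 ℕ.* (c₁ ℕ.* c₂)          ≡⟨ regroup c₁ c₂ ⟩
      c₁ ℕ.* 2 ℕ.* (c₂ ℕ.* 2)    ≡⟨ cong₂ ℕ._*_ a≡ b≡ ⟨
      a ℕ.* b                    ≡⟨ ab≡8m ⟩
      8 ℕ.* m                    ≡⟨ ℕP.*-assoc 4 2 m ⟩
      4 ℕ.* (2 ℕ.* m)            ∎)
      where
      open ≡-Reasoning
      regroup : ∀ c₁ c₂ → 4 ℕ.* (c₁ ℕ.* c₂) ≡ c₁ ℕ.* 2 ℕ.* (c₂ ℕ.* 2)
      regroup = ℕSolver.solve-∀

  odd-coprime-2 : ∀ k → Coprime (2 ℕ.* k ℕ.+ 1) 2
  odd-coprime-2 k = NC.sym (prime∤⇒coprime prime[2] (λ 2∣ → two∤one (ℕD.∣m+n∣m⇒∣n 2∣ (ℕD.divides k (ℕP.*-comm 2 k)))))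
    where two∤one : ¬ (2 ∣ℕ 1)
          two∤one 2∣1 with ℕD.∣1⇒≡1 2∣1
          ... | ()

  prime∤-resp : ∀ {l M y r} → + l ∣ M → y ≈ r [mod M ] → ¬ (+ l ∣ r) → ¬ (+ l ∣ y)
  prime∤-resp {l} {M} {y} {r} l∣M (congruent M∣y-r) l∤r l∣y =
    l∤r (subst (+ l ∣_) (cancel y r) (ℤD.∣m∣n⇒∣m-n l∣y (ℤD.∣-trans l∣M M∣y-r)))
    where cancel : ∀ (y r : ℤ) → y - (y - r) ≡ r
          cancel = solve-∀

  fourth-power-via-crt : ∀ {M r c g₀ y s i} → HasOrder M r (c ℕ.* 2) → g₀ ≈ r [mod M ] →
                         y ≈ r ^ s [mod M ] → i ≡ s [modℕ c ] → y ^ 4 ≈ (g₀ ^ 4) ^ i [mod M ]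
  fourth-power-via-crt {M} {r} {c} {g₀} {y} {s} {i} o g₀≈r y≈r^s i≡s = begin
    y ^ 4              ≈⟨ ≈-^ 4 y≈r^s ⟩
    (r ^ s) ^ 4        ≡⟨ ^-* r s 4 ⟨
    r ^ (s ℕ.* 4)      ≡⟨ cong (r ^_) (ℕP.*-comm s 4) ⟩
    r ^ (4 ℕ.* s)      ≈⟨ fourth-power-exponent-mod o i≡s ⟨
    r ^ (4 ℕ.* i)      ≡⟨ ^-* r 4 i ⟩
    (r ^ 4) ^ i        ≈⟨ ≈-^ i (≈-^ 4 g₀≈r) ⟨
    (g₀ ^ 4) ^ i       ∎
    where open ≈-Reasoning M

  -- If (g₀⁴)^(2i) ≡ 1 then r^(8i) ≡ 1, so 2c ∣ 8i and c ∣ 4i.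
  order-via-crt : ∀ {M r c g₀} → HasOrder M r (c ℕ.* 2) → g₀ ≈ r [mod M ] → ∀ i →
                  (g₀ ^ 4) ^ i * (g₀ ^ 4) ^ i ≈ + 1 [mod M ] → c ∣ℕ 4 ℕ.* i
  order-via-crt {M} {r} {c} {g₀} o g₀≈r i square≈1 =
    ℕD.*-cancelʳ-∣ 2 (subst (c ℕ.* 2 ∣ℕ_) (eight i) (order∣ o (8 ℕ.* i) (begin
      r ^ (8 ℕ.* i)                   ≡⟨ cong (r ^_) (ℕP.*-assoc 2 4 i) ⟩
      r ^ (2 ℕ.* (4 ℕ.* i))           ≡⟨ ^-double r (4 ℕ.* i) ⟨
      r ^ (4 ℕ.* i) * r ^ (4 ℕ.* i)   ≡⟨ cong₂ _*_ (^-* r 4 i) (^-* r 4 i) ⟩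
      (r ^ 4) ^ i * (r ^ 4) ^ i       ≈⟨ ≈-* (≈-^ i (≈-^ 4 g₀≈r)) (≈-^ i (≈-^ 4 g₀≈r)) ⟨
      (g₀ ^ 4) ^ i * (g₀ ^ 4) ^ i     ≈⟨ square≈1 ⟩
      + 1                             ∎)))
    where
    open ≈-Reasoning M
    eight : ∀ i → 8 ℕ.* i ≡ 4 ℕ.* i ℕ.* 2
    eight = ℕSolver.solve-∀

  -- Case n = P·Q with P = p^(α+1), Q = q^(β+1) for distinct odd primes and
  -- gcd(φ(P), φ(Q)) = 2: writing φ(P) = 2c₁, φ(Q) = 2c₂ with c₁c₂ = 2m, the base
  -- is congruent to primitive roots r₁ mod P and r₂ mod Q.  Fourth powers of
  -- units are powers of g₀⁴ by the CRT on exponents; y^(4m) ≡ 1 since φ(P) and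
  -- φ(Q) divide 4m; and (g₀⁴)^i ≡ ±1 gives c₁, c₂ ∣ 4i, so m ∣ 2i, so m ∣ i.
  module PrimePowerProduct {p q} (pr : Prime p) (qr : Prime q) (p≢2 : p ≢ 2) (q≢2 : q ≢ 2) (p≢q : p ≢ q) (α β : ℕ) where

    module DP = DiscreteLogarithm pr α
    module DQ = DiscreteLogarithm qr β

    P Q n : ℕ
    P = DP.M
    Q = DQ.M
    n = P ℕ.* Q

    P⊥Q : Coprime P Q
    P⊥Q = coprime-^ˡ (NC.sym (coprime-^ˡ (NC.sym (distinct-primes-coprime pr qr p≢q)) (suc β))) (suc α)

    r₁ r₂ : ℤ
    r₁ = proj₁ (OddPrimePower.primitive-root pr p≢2 α)
    r₂ = proj₁ (OddPrimePower.primitive-root qr q≢2 β)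
    order-r₁ : HasOrder (+ P) r₁ DP.φM
    order-r₁ = proj₂ (OddPrimePower.primitive-root pr p≢2 α)
    order-r₂ : HasOrder (+ Q) r₂ DQ.φM
    order-r₂ = proj₂ (OddPrimePower.primitive-root qr q≢2 β)

    g₀ : ℤ
    g₀ = proj₁ (crt P⊥Q r₁ r₂)
    g₀≈r₁ : g₀ ≈ r₁ [mod + P ]
    g₀≈r₁ = proj₁ (proj₂ (crt P⊥Q r₁ r₂))
    g₀≈r₂ : g₀ ≈ r₂ [mod + Q ]
    g₀≈r₂ = proj₂ (proj₂ (crt P⊥Q r₁ r₂))

    P∣n : + P ∣ + n
    P∣n = ℤD.∣ᵤ⇒∣ (ℕD.m∣m*n Q)
    Q∣n : + Q ∣ + n
    Q∣n = ℤD.∣ᵤ⇒∣ (ℕD.n∣m*n P)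

    p∤-unit : ∀ {y} → CoprimeTo n y → ¬ (+ p ∣ y)
    p∤-unit = coprimeTo⇒prime∤ pr (ℕD.∣-trans (ℕD.m∣m*n (p ℕ.^ α)) (ℕD.m∣m*n Q))
    q∤-unit : ∀ {y} → CoprimeTo n y → ¬ (+ q ∣ y)
    q∤-unit = coprimeTo⇒prime∤ qr (ℕD.∣-trans (ℕD.m∣m*n (q ℕ.^ β)) (ℕD.n∣m*n P))

    g₀-unit : CoprimeTo n g₀
    g₀-unit = NC.sym (coprime-*ˡ (NC.sym (prime∤⇒coprimeTo pr p∤g₀ (suc α))) (NC.sym (prime∤⇒coprimeTo qr q∤g₀ (suc β))))
      where
      p∤g₀ : ¬ (+ p ∣ g₀)
      p∤g₀ = prime∤-resp DP.p∣M g₀≈r₁ (order⇒prime∤ pr DP.p∣M DP.0<φM order-r₁)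
      q∤g₀ : ¬ (+ q ∣ g₀)
      q∤g₀ = prime∤-resp DQ.p∣M g₀≈r₂ (order⇒prime∤ qr DQ.p∣M DQ.0<φM order-r₂)

    module _ (k : ℕ) (gcd≡2 : gcd (φ P) (φ Q) ≡ 2) (φn≡8m : φ n ≡ 8 ℕ.* (2 ℕ.* k ℕ.+ 1)) where

      m = 2 ℕ.* k ℕ.+ 1
      open Halves (halves DP.φM DQ.φM m (trans (sym (cong₂ gcd (φ-prime^ pr α) (φ-prime^ qr β))) gcd≡2)
                                       (trans (sym (φ-prime^-product pr qr p≢q α β)) φn≡8m))
        renaming (a≡ to φP≡; b≡ to φQ≡)
      order-r₁′ : HasOrder (+ P) r₁ (c₁ ℕ.* 2)
      order-r₁′ = subst (HasOrder (+ P) r₁) φP≡ order-r₁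
      order-r₂′ : HasOrder (+ Q) r₂ (c₂ ℕ.* 2)
      order-r₂′ = subst (HasOrder (+ Q) r₂) φQ≡ order-r₂
      0<c₁ : 0 ℕ.< c₁
      0<c₁ = ℕP.n≢0⇒n>0 (λ c₁≡0 → ℕP.<⇒≢ DP.0<φM (sym (trans φP≡ (cong (ℕ._* 2) c₁≡0))))
      0<c₂ : 0 ℕ.< c₂
      0<c₂ = ℕP.n≢0⇒n>0 (λ c₂≡0 → ℕP.<⇒≢ DQ.0<φM (sym (trans φQ≡ (cong (ℕ._* 2) c₂≡0))))

      fourth-power-log : ∀ y → CoprimeTo n y → Σ ℕ λ i → y ^ 4 ≈ (g₀ ^ 4) ^ i [mod + n ]
      fourth-power-log y y⊥n =
        let (s , y≈r₁^s) = DP.discrete-log r₁ order-r₁ y (p∤-unit y⊥n)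
            (t , y≈r₂^t) = DQ.discrete-log r₂ order-r₂ y (q∤-unit y⊥n)
            (i , i≡s , i≡t) = exponent-crt c₁⊥c₂ 0<c₁ 0<c₂ s t
        in i , ≈-coprime-moduli P⊥Q (fourth-power-via-crt order-r₁′ g₀≈r₁ y≈r₁^s i≡s)
                                    (fourth-power-via-crt order-r₂′ g₀≈r₂ y≈r₂^t i≡t)

      four-m : 4 ℕ.* m ≡ 2 ℕ.* (c₁ ℕ.* c₂)
      four-m = trans (ℕP.*-assoc 2 2 m) (cong (2 ℕ.*_) (sym c₁c₂≡2m))
      φP∣4m : DP.φM ∣ℕ 4 ℕ.* m
      φP∣4m = ℕD.divides c₂ (trans four-m (trans (regroup c₁ c₂) (cong (c₂ ℕ.*_) (sym φP≡))))
        where regroup : ∀ c₁ c₂ → 2 ℕ.* (c₁ ℕ.* c₂) ≡ c₂ ℕ.* (c₁ ℕ.* 2)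
              regroup = ℕSolver.solve-∀
      φQ∣4m : DQ.φM ∣ℕ 4 ℕ.* m
      φQ∣4m = ℕD.divides c₁ (trans four-m (trans (regroup c₁ c₂) (cong (c₁ ℕ.*_) (sym φQ≡))))
        where regroup : ∀ c₁ c₂ → 2 ℕ.* (c₁ ℕ.* c₂) ≡ c₁ ℕ.* (c₂ ℕ.* 2)
              regroup = ℕSolver.solve-∀

      fourth-power-exponent : ∀ y → CoprimeTo n y → y ^ (4 ℕ.* m) ≈±1[mod + n ]
      fourth-power-exponent y y⊥n =
        let (s , y≈r₁^s) = DP.discrete-log r₁ order-r₁ y (p∤-unit y⊥n)
            (t , y≈r₂^t) = DQ.discrete-log r₂ order-r₂ y (q∤-unit y⊥n)
        in inj₁ (≈-coprime-moduli P⊥Q (≈1-multiple _ (power-of-order s order-r₁ y≈r₁^s) φP∣4m)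
                                      (≈1-multiple _ (power-of-order t order-r₂ y≈r₂^t) φQ∣4m))

      generator-order : ∀ i → (g₀ ^ 4) ^ i ≈±1[mod + n ] → m ∣ℕ i
      generator-order i g⁴ⁱ±1 = NC.coprime-divisor (odd-coprime-2 k) (ℕD.*-cancelˡ-∣ 2 (subst (_∣ℕ 2 ℕ.* (2 ℕ.* i)) c₁c₂≡2m
        (subst (c₁ ℕ.* c₂ ∣ℕ_) (ℕP.*-assoc 2 2 i) (coprime-∣* c₁⊥c₂ (order-via-crt order-r₁′ g₀≈r₁ i (≈-divisor P∣n square≈1))
                                                                    (order-via-crt order-r₂′ g₀≈r₂ i (≈-divisor Q∣n square≈1))))))
        where square≈1 = ±1-square g⁴ⁱ±1

      structure : FourthPowerStructure n m
      structure = record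
        { base                  = g₀
        ; base-unit             = g₀-unit
        ; fourth-power-log      = fourth-power-log
        ; fourth-power-exponent = fourth-power-exponent
        ; generator-order       = generator-order
        }

open import Defs
open import Data.Nat using (ℕ; _*_; _+_; _^_; _<_; _≥_)
open import Data.Nat.Primality using (Prime)
open import Data.Nat.GCD using (gcd)
open import Data.Integer as ℤ using (ℤ; +_)
open import Data.Product using (Σ; _×_)
open import Data.Sum using (_⊎_)
open import Relation.Nullary using (¬_)
open import Relation.Binary.PropositionalEquality using (_≡_; _≢_)
open import Data.Nat using (zero; suc)
open import Data.Product using (_,_)
open import Data.Sum using (inj₁; inj₂)
open import Relation.Binary.PropositionalEquality using (refl)
open NumberTheory using (structure⇒conclusion; prime-power-structure; module PrimePowerProduct)

mainTheorem7 :
    (n : ℕ) →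
    ( (Σ ℕ λ p → Σ ℕ λ α → Prime p × p ≢ 2 × α ≥ 1 × n ≡ p ^ α)
    ⊎ (Σ ℕ λ p → Σ ℕ λ α → Σ ℕ λ q → Σ ℕ λ β →
         Prime p × p ≢ 2 × α ≥ 1 × Prime q × q ≢ 2 × β ≥ 1 × p ≢ q ×
         gcd (φ (p ^ α)) (φ (q ^ β)) ≡ 2 × n ≡ p ^ α * q ^ β) ) →
    (k : ℕ) → φ n ≡ 8 * (2 * k + 1) →
    -- biquadratic residues mod⋆ n form a cyclic subgroup of G⋆ₙ of order φ(n)/8 = 2k+1
    ( Σ ℤ λ g →
        BiquadraticResidue⋆ n g
      × ((b : ℤ) → BiquadraticResidue⋆ n b → Σ ℕ λ i → b ≡⋆ (g ℤ.^ i) [mod n ])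
      × ((i : ℕ) → BiquadraticResidue⋆ n (g ℤ.^ i))
      × (g ℤ.^ (2 * k + 1)) ≡⋆ (+ 1) [mod n ]
      × ((i : ℕ) → i ≥ 1 → i < 2 * k + 1 → ¬ ((g ℤ.^ i) ≡⋆ (+ 1) [mod n ])) )
    × ((b : ℤ) → BiquadraticResidue⋆ n b →
         ((b ℤ.^ (k + 1)) ℤ.^ 2) ≡⋆ b [mod n ]
       × BiquadraticResidue⋆ n (b ℤ.^ (k + 1)))
-- Both shapes of n: the exponents are ≥ 1, and φ(n) = 8m with m = 2k+1.
mainTheorem7 n (inj₁ (p , suc α , pr , p≢2 , _ , refl)) k φn≡8m =
  structure⇒conclusion n k (prime-power-structure pr p≢2 α (2 * k + 1) φn≡8m)
mainTheorem7 n (inj₂ (p , suc α , q , suc β , pr , p≢2 , _ , qr , q≢2 , _ , p≢q , gcd≡2 , refl)) k φn≡8m =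
  structure⇒conclusion n k (PrimePowerProduct.structure pr qr p≢2 q≢2 p≢q α β k gcd≡2 φn≡8m)
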